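{- Let $n\geqslant 1$ and let $[N]$ be a conjugacy $n$-class of rank $r$ (the rank of $N$ as a matrix). Suppose $[N]$ has exactly $i$ child classes $[N^{(1)}],\dots,[N^{(i)}]$ (conjugacy $(n+1)$-classes whose parent class is $[N]$). Then $$\sum_{j=1}^{i}\mathrm{matrixdeg}([N^{(j)}])=\frac{q^{n-r}-1}{q-1}+1.$$
   Context: $\mathbb{F}_q$ is the finite field with $q$ elements. $\mathbf{U}^*_k$ denotes the group of invertible upper-triangular $k\times k$ matrices over $\mathbb{F}_q$ and $\mathbf{U}^o_k$ the set of nilpotent upper-triangular $k\times k$ matrices over $\mathbb{F}_q$; $\mathbf{U}^*_k$ acts on $\mathbf{U}^o_k$ by $B.N=B^{ -1}NB$, and an orbit is a conjugacy $k$-class. For $N'\in\mathbf{U}^o_{n+1}$ let $p(N')$ be its top-left $n\times n$ block; the parent class of $[N']$ is $[p(N')]$, and $[N']$ is then a child class of $[p(N')]$. Let $\mathbf{U}^!_{n+1}$ be the subgroup of matrices $\begin{pmatrix} I_n & b\\ 0 & k\end{pmatrix}$, $b\in\mathbb{F}_q^{n\times1}$, $k\in\mathbb{F}_q^*$. For a conjugacy $(n+1)$-class $[N']$ with parent $[N]$, let $B(N;[N'])=\left\{\begin{pmatrix}N&b\\0&0\end{pmatrix}: b\in\mathbb{F}_q^{n\times1}\right\}\cap[N']$; $\mathrm{matrixdeg}([N'])$ is the number of orbits of $\mathbf{U}^!_{n+1}$ acting by conjugation on $B(N;[N'])$ (independent of the choice of $N\in[N]$). -}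

module Defs where

open import Level using (0ℓ)
open import Data.Nat using (ℕ; zero; suc; NonZero; _∸_)
open import Data.Fin using (Fin; zero; suc; _<_)
open import Data.Product using (Σ; _×_; _,_; ∃)
open import Data.Empty using (⊥; ⊥-elim)
open import Relation.Nullary using (¬_; yes; no)
import Data.Nat
import Data.Fin
open import Relation.Binary.PropositionalEquality using (_≡_; _≢_; refl; sym; trans; cong)
open import Algebra.Structures using (IsCommutativeRing)

-- A finite field F_q : a commutative ring (with propositional equality)
-- in which 0 ≠ 1 and every nonzero element has a multiplicative inverse,
-- together with a bijection Carrier ≅ Fin size (so q = size).

record FiniteField : Set₁ where
  field
    Carrier : Set
    _+_ _*_ : Carrier → Carrier → Carrier
    -_      : Carrier → Carrier
    0# 1#   : Carrier
    isCommutativeRing : IsCommutativeRing _≡_ _+_ _*_ -_ 0# 1#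
    0≢1     : 0# ≢ 1#
    inv     : (x : Carrier) → x ≢ 0# → Carrier
    inv-r   : (x : Carrier) (x≢0 : x ≢ 0#) → x * inv x x≢0 ≡ 1#
    size    : ℕ
    enum    : Fin size → Carrier
    index   : Carrier → Fin size
    enum-index : ∀ x → enum (index x) ≡ x
    index-enum : ∀ i → index (enum i) ≡ i

-- q ∸ 1 is nonzero (since 0 ≠ 1, the field has at least two elements)
q∸1-nonZero : (F : FiniteField) → NonZero (FiniteField.size F ∸ 1)
q∸1-nonZero F = go size index (λ {x} {y} e → trans (sym (enum-index x)) (trans (cong enum e) (enum-index y)))
  where
  open FiniteField F
  go : (s : ℕ) (ix : Carrier → Fin s) → (∀ {x y} → ix x ≡ ix y → x ≡ y) → NonZero (s ∸ 1)
  go zero ix inj with ix 0#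
  ... | ()
  go (suc zero) ix inj with ix 0# in e0 | ix 1# in e1
  ... | zero | zero = ⊥-elim (0≢1 (inj (trans e0 (sym e1))))
  go (suc (suc s)) ix inj = _

sumℕ : (i : ℕ) → (Fin i → ℕ) → ℕ
sumℕ zero    f = 0
sumℕ (suc i) f = f zero Data.Nat.+ sumℕ i (λ j → f (suc j))

module Matrices (F : FiniteField) where
  open FiniteField F

  q : ℕ
  q = size

  Mat : ℕ → ℕ → Set
  Mat m n = Fin m → Fin n → Carrier

  sumF : (n : ℕ) → (Fin n → Carrier) → Carrier
  sumF zero    f = 0#
  sumF (suc n) f = f zero + sumF n (λ j → f (suc j))

  _⊗_ : {l m n : ℕ} → Mat l m → Mat m n → Mat l n
  _⊗_ {m = m} A B i k = sumF m (λ j → A i j * B j k)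

  idM : (n : ℕ) → Mat n n
  idM n i j with i Data.Fin.≟ j
  ... | yes _ = 1#
  ... | no  _ = 0#

  zeroM : (m n : ℕ) → Mat m n
  zeroM m n _ _ = 0#

  _≋_ : {m n : ℕ} → Mat m n → Mat m n → Set
  A ≋ B = ∀ i j → A i j ≡ B i j

  pow : {n : ℕ} → Mat n n → ℕ → Mat n n
  pow {n} A zero    = idM n
  pow {n} A (suc k) = A ⊗ pow A k

  UpperTri : {n : ℕ} → Mat n n → Set
  UpperTri A = ∀ i j → j < i → A i j ≡ 0#

  Nilpotent : {n : ℕ} → Mat n n → Set
  Nilpotent {n} A = ∃ λ k → pow A k ≋ zeroM n n

  Uo : (k : ℕ) → Mat k k → Set
  Uo k A = UpperTri A × Nilpotent A

  ConjBy : {k : ℕ} → Mat k k → Mat k k → Mat k k → Set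
  ConjBy {k} B M M' = Σ (Mat k k) λ C →
    ((B ⊗ C) ≋ idM k) × ((C ⊗ B) ≋ idM k) × (((C ⊗ M) ⊗ B) ≋ M')

  Conj : (k : ℕ) → Mat k k → Mat k k → Set
  Conj k M M' = Σ (Mat k k) λ B → UpperTri B × ConjBy B M M'

  -- case split on Fin (suc n): inject₁ i ↦ f i, the last index ↦ a
  caseLast : {A : Set} {n : ℕ} → (Fin n → A) → A → Fin (suc n) → A
  caseLast {n = zero}  f a zero    = a
  caseLast {n = suc n} f a zero    = f zero
  caseLast {n = suc n} f a (suc i) = caseLast (λ j → f (suc j)) a i

  -- block matrix ( N b ; c d )
  block : {n : ℕ} → Mat n n → (Fin n → Carrier) → (Fin n → Carrier) → Carrier
        → Mat (suc n) (suc n)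
  block N b c d = caseLast (λ i → caseLast (N i) (b i)) (caseLast c d)

  zeroV : (n : ℕ) → Fin n → Carrier
  zeroV n _ = 0#

  top : {n : ℕ} → Mat (suc n) (suc n) → Mat n n
  top N' i j = N' (Data.Fin.inject₁ i) (Data.Fin.inject₁ j)

  BangConj : {n : ℕ} → Mat (suc n) (suc n) → Mat (suc n) (suc n) → Set
  BangConj {n} M M' = Σ (Fin n → Carrier) λ b → Σ Carrier λ k →
    (k ≢ 0#) × ConjBy (block (idM n) b (zeroV n) k) M M'

  -- "the action of a group with orbit relation R on the set S has exactly
  -- d orbits": d pairwise inequivalent representatives covering S
  HasOrbitCount : {X : Set} → (X → Set) → (X → X → Set) → ℕ → Set
  HasOrbitCount {X} S R d = Σ (Fin d → X) λ rep →
    (∀ j → S (rep j)) ×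
    (∀ j j' → R (rep j) (rep j') → j ≡ j') ×
    (∀ x → S x → ∃ λ j → R (rep j) x)

  -- B(N;[N']) parametrised by the column b : (N b ; 0 0) ∈ [N']
  Bset : {n : ℕ} → Mat n n → Mat (suc n) (suc n) → (Fin n → Carrier) → Set
  Bset {n} N N' b = Conj (suc n) (block N b (zeroV n) 0#) N'

  -- matrixdeg([N']) = d (computed with respect to the parent representative N)
  MatrixDeg : {n : ℕ} → Mat n n → Mat (suc n) (suc n) → ℕ → Set
  MatrixDeg {n} N N' d = HasOrbitCount (Bset N N')
    (λ b b' → BangConj (block N b (zeroV n) 0#) (block N b' (zeroV n) 0#)) d

  LinIndepCols : {m n r : ℕ} → Mat m n → (Fin r → Fin n) → Set
  LinIndepCols {m} {n} {r} A cols = (c : Fin r → Carrier) →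
    (∀ i → sumF r (λ k → c k * A i (cols k)) ≡ 0#) → ∀ k → c k ≡ 0#

  Rank : {m n : ℕ} → Mat m n → ℕ → Set
  Rank {m} {n} A r =
    (Σ (Fin r → Fin n) λ cols → LinIndepCols A cols) ×
    ((cols : Fin (suc r) → Fin n) → ¬ LinIndepCols A cols)

open Matrices public

{-# OPTIONS --safe #-}
module Submission where

-- Every extension (N b; 0 0) of N lies in exactly one child class of [N], and U^!_{n+1} acts on
-- these extensions by b ↦ k b + N c with k ≠ 0. Hence the matrix degrees of the children add up
-- to the number of classes of vectors b modulo the column space W of N and nonzero scalars: the
-- class W itself together with the (q^(n−r) − 1)/(q − 1) lines of F^n/W. This count is obtained
-- by Gaussian elimination on r independent columns spanning W, by induction on the dimension.

open import Defs using (FiniteField; sumℕ; q∸1-nonZero; module Matrices)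
open import Data.Nat using (ℕ; zero; suc; NonZero; _<_; _≤_; _∸_; _^_; z≤n; s≤s)
open import Data.Fin using (Fin; zero; suc; inject₁; fromℕ; punchIn; splitAt; join; combine; remQuot)
open import Data.Product using (_×_; _,_; ∃; proj₁; proj₂; uncurry)
open import Data.Empty using (⊥-elim)
open import Data.Unit using (⊤; tt)
open import Data.Sum using (_⊎_; inj₁; inj₂; [_,_]′)
open import Relation.Nullary using (¬_; ¬?; Dec; yes; no)
open import Relation.Nullary.Decidable using (decidable-stable)
open import Relation.Binary.PropositionalEquality
open import Function using (_∘_; _$_)
open import Data.Vec.Functional using (Vector; _∷_; tail; insertAt; removeAt)
open import Data.Vec.Functional.Properties using (insertAt-lookup; insertAt-punchIn; insertAt-removeAt)
open import Data.Fin.Relation.Unary.Top using (view; ‵fromℕ; ‵inject₁)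
open import Algebra.Bundles using (CommutativeRing)
import Data.Fin.Properties
open import Data.Fin.Properties
  using (any?; injective⇒≤; toℕ-inject₁; toℕ-fromℕ; toℕ<n; suc-injective; join-splitAt; splitAt-join; combine-remQuot; remQuot-combine)
import Data.Fin.Induction
import Data.Nat.Properties as ℕ
open import Induction.WellFounded using (module All)
open import Relation.Binary.Bundles using (Setoid)
import Relation.Binary.Reasoning.Setoid
open import Relation.Binary.Definitions using (tri<; tri≈; tri>)

module GeometricSeries where
  open import Data.Nat using (_+_; _*_)
  open import Data.Nat.DivMod using (_/_; m*n/n≡m)
  open import Data.Nat.Properties using (*-distribʳ-+; +-assoc; +-comm; *-comm; m+n∸n≡m)

  geometricSum : ℕ → ℕ → ℕ
  geometricSum q zero    = 0
  geometricSum q (suc t) = geometricSum q t + q ^ t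

  geometricSum*pred+1 : ∀ k t → geometricSum (suc k) t * k + 1 ≡ suc k ^ t
  geometricSum*pred+1 k zero    = refl
  geometricSum*pred+1 k (suc t) = begin
    (S + Q ^ t) * k + 1        ≡⟨ cong (_+ 1) (*-distribʳ-+ k S (Q ^ t)) ⟩
    (S * k + Q ^ t * k) + 1    ≡⟨ +-assoc (S * k) _ 1 ⟩
    S * k + (Q ^ t * k + 1)    ≡⟨ cong (S * k +_) (+-comm _ 1) ⟩
    S * k + (1 + Q ^ t * k)    ≡⟨ +-assoc (S * k) 1 _ ⟨
    (S * k + 1) + Q ^ t * k    ≡⟨ cong (_+ Q ^ t * k) (geometricSum*pred+1 k t) ⟩
    Q ^ t + Q ^ t * k          ≡⟨ cong (Q ^ t +_) (*-comm (Q ^ t) k) ⟩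
    Q ^ t + k * Q ^ t          ∎
    where
    open ≡-Reasoning
    Q = suc k
    S = geometricSum Q t

  suc-geometricSum : ∀ q t .{{_ : NonZero (q ∸ 1)}} →
                     suc (geometricSum q t) ≡ (q ^ t ∸ 1) / (q ∸ 1) + 1
  suc-geometricSum (suc k) t = begin
    suc (geometricSum Q t)                ≡⟨ +-comm 1 _ ⟩
    geometricSum Q t + 1                  ≡⟨ cong (_+ 1) (m*n/n≡m (geometricSum Q t) k) ⟨
    (geometricSum Q t * k) / k + 1        ≡⟨ cong (λ x → x / k + 1) (m+n∸n≡m _ 1) ⟨
    (geometricSum Q t * k + 1 ∸ 1) / k + 1 ≡⟨ cong (λ x → (x ∸ 1) / k + 1) (geometricSum*pred+1 k t) ⟩
    (Q ^ t ∸ 1) / k + 1                   ∎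
    where
    open ≡-Reasoning
    Q = suc k

open GeometricSeries using (geometricSum; suc-geometricSum)

module _ (F : FiniteField) where
  open FiniteField F
    using (Carrier; isCommutativeRing; 0≢1; inv; inv-r; enum; index; enum-index; index-enum)
  open Matrices F

  field-ring : CommutativeRing _ _
  field-ring = record { isCommutativeRing = isCommutativeRing }

  open CommutativeRing field-ring
    using (_+_; _*_; -_; 0#; 1#; +-assoc; +-comm; +-identityˡ; +-identityʳ; -‿inverseˡ; -‿inverseʳ;
           *-assoc; *-comm; *-identityˡ; *-identityʳ; distribˡ; distribʳ; zeroˡ; zeroʳ)
  open import Algebra.Properties.Ring (CommutativeRing.ring field-ring) using (-‿distribˡ-*; -‿distribʳ-*; -1*x≈-x)
  open import Algebra.Properties.AbelianGroup (CommutativeRing.+-abelianGroup field-ring) using () renaming (∙-cancelʳ to +-cancelʳ)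
  open import Algebra.Properties.Semiring.Sum (CommutativeRing.semiring field-ring)
    using (sum; sum-cong-≗; sum-replicate-zero; ∑-distrib-+; ∑-comm; sum-remove; sum-init-last;
           *-distribˡ-sum; *-distribʳ-sum)

  _≟_ : (x y : Carrier) → Dec (x ≡ y)
  x ≟ y with index x Data.Fin.≟ index y
  ... | yes eq = yes (trans (sym (enum-index x)) (trans (cong enum eq) (enum-index y)))
  ... | no neq = no (neq ∘ cong index)

  1≢0 : 1# ≢ 0#
  1≢0 = 0≢1 ∘ sym

  inv-l : ∀ x (x≢0 : x ≢ 0#) → inv x x≢0 * x ≡ 1#
  inv-l x x≢0 = trans (*-comm _ x) (inv-r x x≢0)

  inv-*-cancel : ∀ x (x≢0 : x ≢ 0#) y → inv x x≢0 * (x * y) ≡ y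
  inv-*-cancel x x≢0 y = begin
    inv x x≢0 * (x * y)  ≡⟨ *-assoc _ x y ⟨
    inv x x≢0 * x * y    ≡⟨ cong (_* y) (inv-l x x≢0) ⟩
    1# * y               ≡⟨ *-identityˡ y ⟩
    y                    ∎
    where open ≡-Reasoning

  *-inv-cancel : ∀ x (x≢0 : x ≢ 0#) y → x * (inv x x≢0 * y) ≡ y
  *-inv-cancel x x≢0 y = begin
    x * (inv x x≢0 * y)  ≡⟨ *-assoc x _ y ⟨
    x * inv x x≢0 * y    ≡⟨ cong (_* y) (inv-r x x≢0) ⟩
    1# * y               ≡⟨ *-identityˡ y ⟩
    y                    ∎
    where open ≡-Reasoning

  inv≢0 : ∀ x (x≢0 : x ≢ 0#) → inv x x≢0 ≢ 0#
  inv≢0 x x≢0 inv≡0 = 1≢0 (begin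
    1#              ≡⟨ inv-r x x≢0 ⟨
    x * inv x x≢0   ≡⟨ cong (x *_) inv≡0 ⟩
    x * 0#          ≡⟨ zeroʳ x ⟩
    0#              ∎)
    where open ≡-Reasoning

  *-cancelʳ-nonzero : ∀ {x y z} → z ≢ 0# → x * z ≡ y * z → x ≡ y
  *-cancelʳ-nonzero {x} {y} {z} z≢0 xz≡yz = begin
    x                     ≡⟨ inv-*-cancel z z≢0 x ⟨
    inv z z≢0 * (z * x)   ≡⟨ cong (inv z z≢0 *_) (trans (*-comm z x) (trans xz≡yz (*-comm y z))) ⟩
    inv z z≢0 * (z * y)   ≡⟨ inv-*-cancel z z≢0 y ⟩
    y                     ∎
    where open ≡-Reasoning

  x*y≡0⇒x≡0 : ∀ {x y} → x * y ≡ 0# → y ≢ 0# → x ≡ 0#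
  x*y≡0⇒x≡0 {x} {y} xy≡0 y≢0 = *-cancelʳ-nonzero y≢0 (trans xy≡0 (sym (zeroˡ y)))

  *-nonzero : ∀ {x y} → x ≢ 0# → y ≢ 0# → x * y ≢ 0#
  *-nonzero x≢0 y≢0 xy≡0 = x≢0 (x*y≡0⇒x≡0 xy≡0 y≢0)

  sumF≡sum : ∀ n (f : Fin n → Carrier) → sumF n f ≡ sum f
  sumF≡sum zero    f = refl
  sumF≡sum (suc n) f = cong (f zero +_) (sumF≡sum n (f ∘ suc))

  sumF-cong : ∀ {n} {f g : Fin n → Carrier} → (∀ l → f l ≡ g l) → sumF n f ≡ sumF n g
  sumF-cong {zero}  f≗g = refl
  sumF-cong {suc n} f≗g = cong₂ _+_ (f≗g zero) (sumF-cong (f≗g ∘ suc))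

  sumF-zero : ∀ {n} {f : Fin n → Carrier} → (∀ l → f l ≡ 0#) → sumF n f ≡ 0#
  sumF-zero {n} f≗0 = trans (sumF-cong f≗0) (trans (sumF≡sum n _) (sum-replicate-zero n))

  sumF-+ : ∀ {n} (f g : Fin n → Carrier) → sumF n (λ l → f l + g l) ≡ sumF n f + sumF n g
  sumF-+ {n} f g = begin
    sumF n (λ l → f l + g l)  ≡⟨ sumF≡sum n _ ⟩
    sum (λ l → f l + g l)     ≡⟨ ∑-distrib-+ f g ⟩
    sum f + sum g             ≡⟨ cong₂ _+_ (sumF≡sum n f) (sumF≡sum n g) ⟨
    sumF n f + sumF n g       ∎
    where open ≡-Reasoning

  *-distribˡ-sumF : ∀ {n} x (f : Fin n → Carrier) → x * sumF n f ≡ sumF n (λ l → x * f l)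
  *-distribˡ-sumF {n} x f = begin
    x * sumF n f            ≡⟨ cong (x *_) (sumF≡sum n f) ⟩
    x * sum f               ≡⟨ *-distribˡ-sum x f ⟩
    sum (λ l → x * f l)     ≡⟨ sumF≡sum n _ ⟨
    sumF n (λ l → x * f l)  ∎
    where open ≡-Reasoning

  *-distribʳ-sumF : ∀ {n} x (f : Fin n → Carrier) → sumF n f * x ≡ sumF n (λ l → f l * x)
  *-distribʳ-sumF {n} x f = begin
    sumF n f * x            ≡⟨ cong (_* x) (sumF≡sum n f) ⟩
    sum f * x               ≡⟨ *-distribʳ-sum x f ⟩
    sum (λ l → f l * x)     ≡⟨ sumF≡sum n _ ⟨
    sumF n (λ l → f l * x)  ∎
    where open ≡-Reasoning

  -‿distrib-sumF : ∀ {n} (f : Fin n → Carrier) → - sumF n f ≡ sumF n (λ l → - f l)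
  -‿distrib-sumF {n} f = begin
    - sumF n f                  ≡⟨ -1*x≈-x _ ⟨
    - 1# * sumF n f             ≡⟨ *-distribˡ-sumF (- 1#) f ⟩
    sumF n (λ l → - 1# * f l)   ≡⟨ sumF-cong (λ l → -1*x≈-x (f l)) ⟩
    sumF n (λ l → - f l)        ∎
    where open ≡-Reasoning

  sumF-comm : ∀ {a b} (h : Fin a → Fin b → Carrier) →
              sumF a (λ l → sumF b (h l)) ≡ sumF b (λ m → sumF a (λ l → h l m))
  sumF-comm {a} {b} h = begin
    sumF a (λ l → sumF b (h l))          ≡⟨ trans (sumF≡sum a _) (sum-cong-≗ (λ l → sumF≡sum b (h l))) ⟩
    sum (λ l → sum (h l))                ≡⟨ ∑-comm h ⟩
    sum (λ m → sum (λ l → h l m))        ≡⟨ trans (sumF≡sum b _) (sum-cong-≗ (λ m → sumF≡sum a (λ l → h l m))) ⟨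
    sumF b (λ m → sumF a (λ l → h l m))  ∎
    where open ≡-Reasoning

  sumF-remove : ∀ {n} (l₀ : Fin (suc n)) (f : Fin (suc n) → Carrier) →
                sumF (suc n) f ≡ f l₀ + sumF n (f ∘ punchIn l₀)
  sumF-remove {n} l₀ f = begin
    sumF (suc n) f                  ≡⟨ sumF≡sum (suc n) f ⟩
    sum f                           ≡⟨ sum-remove {i = l₀} f ⟩
    f l₀ + sum (f ∘ punchIn l₀)     ≡⟨ cong (f l₀ +_) (sumF≡sum n _) ⟨
    f l₀ + sumF n (f ∘ punchIn l₀)  ∎
    where open ≡-Reasoning

  sumF-init-last : ∀ {n} (f : Fin (suc n) → Carrier) → sumF (suc n) f ≡ sumF n (f ∘ inject₁) + f (fromℕ n)
  sumF-init-last {n} f = begin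
    sumF (suc n) f                      ≡⟨ sumF≡sum (suc n) f ⟩
    sum f                               ≡⟨ sum-init-last f ⟩
    sum (f ∘ inject₁) + f (fromℕ n)     ≡⟨ cong (_+ f (fromℕ n)) (sumF≡sum n _) ⟨
    sumF n (f ∘ inject₁) + f (fromℕ n)  ∎
    where open ≡-Reasoning

  sumF-δ : ∀ {n} (f : Fin n → Carrier) (j : Fin n) → (∀ l → l ≢ j → f l ≡ 0#) → sumF n f ≡ f j
  sumF-δ {suc n} f j f≡0 = begin
    sumF (suc n) f                ≡⟨ sumF-remove j f ⟩
    f j + sumF n (f ∘ punchIn j)  ≡⟨ cong (f j +_) (sumF-zero (λ l → f≡0 (punchIn j l) (Data.Fin.Properties.punchInᵢ≢i j l))) ⟩
    f j + 0#                      ≡⟨ +-identityʳ (f j) ⟩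
    f j                           ∎
    where open ≡-Reasoning

  idM-diag : ∀ {n} (i : Fin n) → idM n i i ≡ 1#
  idM-diag i with i Data.Fin.≟ i
  ... | yes _   = refl
  ... | no i≢i = ⊥-elim (i≢i refl)

  idM-offDiag : ∀ {n} (i j : Fin n) → i ≢ j → idM n i j ≡ 0#
  idM-offDiag i j i≢j with i Data.Fin.≟ j
  ... | yes i≡j = ⊥-elim (i≢j i≡j)
  ... | no _    = refl

  sumF-idMˡ : ∀ {n} (i : Fin n) (v : Fin n → Carrier) → sumF n (λ l → idM n i l * v l) ≡ v i
  sumF-idMˡ i v = begin
    sumF _ (λ l → idM _ i l * v l)  ≡⟨ sumF-δ _ i (λ l l≢i → trans (cong (_* v l) (idM-offDiag i l (l≢i ∘ sym))) (zeroˡ _)) ⟩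
    idM _ i i * v i                 ≡⟨ cong (_* v i) (idM-diag i) ⟩
    1# * v i                        ≡⟨ *-identityˡ (v i) ⟩
    v i                             ∎
    where open ≡-Reasoning

  sumF-idMʳ : ∀ {n} (j : Fin n) (v : Fin n → Carrier) → sumF n (λ l → v l * idM n l j) ≡ v j
  sumF-idMʳ j v = begin
    sumF _ (λ l → v l * idM _ l j)  ≡⟨ sumF-δ _ j (λ l l≢j → trans (cong (v l *_) (idM-offDiag l j l≢j)) (zeroʳ _)) ⟩
    v j * idM _ j j                 ≡⟨ cong (v j *_) (idM-diag j) ⟩
    v j * 1#                        ≡⟨ *-identityʳ (v j) ⟩
    v j                             ∎
    where open ≡-Reasoning

  ≋-setoid : ℕ → ℕ → Setoid _ _
  ≋-setoid m n = record
    { Carrier       = Mat m n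
    ; _≈_           = _≋_
    ; isEquivalence = record
      { refl  = λ _ _ → refl
      ; sym   = λ A≋B i j → sym (A≋B i j)
      ; trans = λ A≋B B≋C i j → trans (A≋B i j) (B≋C i j)
      }
    }

  module _ {m n : ℕ} where
    open Setoid (≋-setoid m n) public using () renaming (refl to ≋-refl; sym to ≋-sym; trans to ≋-trans)

  module ≋-Reasoning {m n : ℕ} = Relation.Binary.Reasoning.Setoid (≋-setoid m n)

  ⊗-congˡ : ∀ {l m n} (A : Mat l m) {B B′ : Mat m n} → B ≋ B′ → (A ⊗ B) ≋ (A ⊗ B′)
  ⊗-congˡ A B≋B′ i k = sumF-cong (λ j → cong (A i j *_) (B≋B′ j k))

  ⊗-congʳ : ∀ {l m n} {A A′ : Mat l m} (B : Mat m n) → A ≋ A′ → (A ⊗ B) ≋ (A′ ⊗ B)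
  ⊗-congʳ B A≋A′ i k = sumF-cong (λ j → cong (_* B j k) (A≋A′ i j))

  ⊗-identityˡ : ∀ {m n} (A : Mat m n) → (idM m ⊗ A) ≋ A
  ⊗-identityˡ A i j = sumF-idMˡ i (λ l → A l j)

  ⊗-identityʳ : ∀ {m n} (A : Mat m n) → (A ⊗ idM n) ≋ A
  ⊗-identityʳ A i j = sumF-idMʳ j (A i)

  ⊗-assoc : ∀ {a b c d} (A : Mat a b) (B : Mat b c) (C : Mat c d) → ((A ⊗ B) ⊗ C) ≋ (A ⊗ (B ⊗ C))
  ⊗-assoc {a} {b} {c} {d} A B C i k = begin
    sumF c (λ m → sumF b (λ l → A i l * B l m) * C m k)
      ≡⟨ sumF-cong {c} (λ m → *-distribʳ-sumF (C m k) (λ l → A i l * B l m)) ⟩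
    sumF c (λ m → sumF b (λ l → A i l * B l m * C m k))
      ≡⟨ sumF-comm (λ m l → A i l * B l m * C m k) ⟩
    sumF b (λ l → sumF c (λ m → A i l * B l m * C m k))
      ≡⟨ sumF-cong {b} (λ l → trans (sumF-cong {c} (λ m → *-assoc (A i l) _ _)) (sym (*-distribˡ-sumF {c} (A i l) _))) ⟩
    sumF b (λ l → A i l * sumF c (λ m → B l m * C m k)) ∎
    where open ≡-Reasoning

  UpperTri-idM : ∀ {n} → UpperTri (idM n)
  UpperTri-idM i j j<i = idM-offDiag i j (λ i≡j → Data.Fin.Properties.<-irrefl (sym i≡j) j<i)

  UpperTri-⊗ : ∀ {n} {A B : Mat n n} → UpperTri A → UpperTri B → UpperTri (A ⊗ B)
  UpperTri-⊗ {n} {A} {B} A-ut B-ut i j j<i = sumF-zero term≡0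
    where
    term≡0 : ∀ l → A i l * B l j ≡ 0#
    term≡0 l with Data.Fin.Properties.<-cmp l i
    ... | tri< l<i _ _  = trans (cong (_* B l j) (A-ut i l l<i)) (zeroˡ _)
    ... | tri≈ _ refl _ = trans (cong (A i l *_) (B-ut l j j<i)) (zeroʳ _)
    ... | tri> _ _ i<l  = trans (cong (A i l *_) (B-ut l j (Data.Fin.Properties.<-trans j<i i<l))) (zeroʳ _)

  UpperTri-leftInverse : ∀ {n} {B C : Mat n n} → UpperTri B → (C ⊗ B) ≋ idM n → UpperTri C
  UpperTri-leftInverse {n} {B} {C} B-ut CB≋I i j j<i =
    All.wfRec Data.Fin.Induction.<-wellFounded _ BelowDiagonalZero column-zero j i j<i
    where
    BelowDiagonalZero : Fin n → Set
    BelowDiagonalZero j = ∀ i → j Data.Fin.< i → C i j ≡ 0#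

    -- Below the diagonal (C ⊗ B) i j ≡ C i j * B j j once the earlier columns of C vanish,
    -- and B j j ≢ 0# because (C ⊗ B) j j ≡ 1#.
    column-zero : ∀ j → (∀ {l} → l Data.Fin.< j → BelowDiagonalZero l) → BelowDiagonalZero j
    column-zero j earlier-columns i j<i = x*y≡0⇒x≡0 (begin
      C i j * B j j  ≡⟨ product-entry i (ℕ.<⇒≯ j<i) ⟨
      (C ⊗ B) i j    ≡⟨ CB≋I i j ⟩
      idM n i j      ≡⟨ idM-offDiag i j (Data.Fin.Properties.<⇒≢ j<i ∘ sym) ⟩
      0#             ∎) Bjj≢0
      where
      open ≡-Reasoning
      product-entry : ∀ i → ¬ (i Data.Fin.< j) → (C ⊗ B) i j ≡ C i j * B j j
      product-entry i i≮j = sumF-δ _ j term≡0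
        where
        term≡0 : ∀ l → l ≢ j → C i l * B l j ≡ 0#
        term≡0 l l≢j with Data.Fin.Properties.<-cmp l j
        ... | tri< l<j _ _ = trans (cong (_* B l j) (earlier-columns l<j i (ℕ.<-≤-trans l<j (ℕ.≮⇒≥ i≮j)))) (zeroˡ _)
        ... | tri≈ _ l≡j _ = ⊥-elim (l≢j l≡j)
        ... | tri> _ _ j<l = trans (cong (C i l *_) (B-ut l j j<l)) (zeroʳ _)
      Bjj≢0 : B j j ≢ 0#
      Bjj≢0 Bjj≡0 = 1≢0 (begin
        1#              ≡⟨ idM-diag j ⟨
        idM n j j       ≡⟨ CB≋I j j ⟨
        (C ⊗ B) j j     ≡⟨ product-entry j (ℕ.<-irrefl refl) ⟩
        C j j * B j j   ≡⟨ cong (C j j *_) Bjj≡0 ⟩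
        C j j * 0#      ≡⟨ zeroʳ _ ⟩
        0#              ∎)

  ⊗-inverse : ∀ {n} {X Y Z W : Mat n n} → (Y ⊗ Z) ≋ idM n → (X ⊗ W) ≋ idM n → ((X ⊗ Y) ⊗ (Z ⊗ W)) ≋ idM n
  ⊗-inverse {n} {X} {Y} {Z} {W} YZ≋I XW≋I = begin
    (X ⊗ Y) ⊗ (Z ⊗ W)    ≈⟨ ⊗-assoc X Y (Z ⊗ W) ⟩
    X ⊗ (Y ⊗ (Z ⊗ W))    ≈⟨ ⊗-congˡ X (⊗-assoc Y Z W) ⟨
    X ⊗ ((Y ⊗ Z) ⊗ W)    ≈⟨ ⊗-congˡ X (⊗-congʳ W YZ≋I) ⟩
    X ⊗ (idM n ⊗ W)      ≈⟨ ⊗-congˡ X (⊗-identityˡ W) ⟩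
    X ⊗ W                ≈⟨ XW≋I ⟩
    idM n                ∎
    where open ≋-Reasoning

  ConjBy-intertwines : ∀ {n} {B C M M′ : Mat n n} → (B ⊗ C) ≋ idM n → ((C ⊗ M) ⊗ B) ≋ M′ →
                       (B ⊗ M′) ≋ (M ⊗ B)
  ConjBy-intertwines {n} {B} {C} {M} {M′} BC≋I CMB≋M′ = begin
    B ⊗ M′                ≈⟨ ⊗-congˡ B CMB≋M′ ⟨
    B ⊗ ((C ⊗ M) ⊗ B)     ≈⟨ ⊗-assoc B (C ⊗ M) B ⟨
    (B ⊗ (C ⊗ M)) ⊗ B     ≈⟨ ⊗-congʳ B (⊗-assoc B C M) ⟨
    ((B ⊗ C) ⊗ M) ⊗ B     ≈⟨ ⊗-congʳ B (⊗-congʳ M BC≋I) ⟩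
    (idM n ⊗ M) ⊗ B       ≈⟨ ⊗-congʳ B (⊗-identityˡ M) ⟩
    M ⊗ B                 ∎
    where open ≋-Reasoning

  ≋⇒Conj : ∀ {n} {M M′ : Mat n n} → M ≋ M′ → Conj n M M′
  ≋⇒Conj {n} {M} M≋M′ = idM n , UpperTri-idM , idM n , ⊗-identityˡ (idM n) , ⊗-identityˡ (idM n) ,
    ≋-trans (⊗-identityʳ (idM n ⊗ M)) (≋-trans (⊗-identityˡ M) M≋M′)

  Conj-sym : ∀ {n} {M M′ : Mat n n} → Conj n M M′ → Conj n M′ M
  Conj-sym {n} {M} {M′} (B , B-ut , C , BC≋I , CB≋I , CMB≋M′) =
    C , UpperTri-leftInverse B-ut CB≋I , B , CB≋I , BC≋I , (begin
      (B ⊗ M′) ⊗ C   ≈⟨ ⊗-congʳ C (ConjBy-intertwines BC≋I CMB≋M′) ⟩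
      (M ⊗ B) ⊗ C    ≈⟨ ⊗-assoc M B C ⟩
      M ⊗ (B ⊗ C)    ≈⟨ ⊗-congˡ M BC≋I ⟩
      M ⊗ idM n      ≈⟨ ⊗-identityʳ M ⟩
      M              ∎)
    where open ≋-Reasoning

  Conj-trans : ∀ {n} {M M′ M″ : Mat n n} → Conj n M M′ → Conj n M′ M″ → Conj n M M″
  Conj-trans {n} {M} {M′} {M″} (B₁ , B₁-ut , C₁ , B₁C₁≋I , C₁B₁≋I , C₁MB₁≋M′)
                               (B₂ , B₂-ut , C₂ , B₂C₂≋I , C₂B₂≋I , C₂M′B₂≋M″) =
    B₁ ⊗ B₂ , UpperTri-⊗ B₁-ut B₂-ut , C₂ ⊗ C₁ , ⊗-inverse B₂C₂≋I B₁C₁≋I , ⊗-inverse C₁B₁≋I C₂B₂≋I , (begin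
      ((C₂ ⊗ C₁) ⊗ M) ⊗ (B₁ ⊗ B₂)   ≈⟨ ⊗-congʳ (B₁ ⊗ B₂) (⊗-assoc C₂ C₁ M) ⟩
      (C₂ ⊗ (C₁ ⊗ M)) ⊗ (B₁ ⊗ B₂)   ≈⟨ ⊗-assoc C₂ (C₁ ⊗ M) (B₁ ⊗ B₂) ⟩
      C₂ ⊗ ((C₁ ⊗ M) ⊗ (B₁ ⊗ B₂))   ≈⟨ ⊗-congˡ C₂ (⊗-assoc (C₁ ⊗ M) B₁ B₂) ⟨
      C₂ ⊗ (((C₁ ⊗ M) ⊗ B₁) ⊗ B₂)   ≈⟨ ⊗-congˡ C₂ (⊗-congʳ B₂ C₁MB₁≋M′) ⟩
      C₂ ⊗ (M′ ⊗ B₂)                ≈⟨ ⊗-assoc C₂ M′ B₂ ⟨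
      (C₂ ⊗ M′) ⊗ B₂                ≈⟨ C₂M′B₂≋M″ ⟩
      M″                            ∎)
    where open ≋-Reasoning

  caseLast-inject₁ : ∀ {A : Set} {n} (f : Fin n → A) a (i : Fin n) → caseLast f a (inject₁ i) ≡ f i
  caseLast-inject₁ {n = suc n} f a zero    = refl
  caseLast-inject₁ {n = suc n} f a (suc i) = caseLast-inject₁ (f ∘ suc) a i

  caseLast-fromℕ : ∀ {A : Set} {n} (f : Fin n → A) a → caseLast f a (fromℕ n) ≡ a
  caseLast-fromℕ {n = zero}  f a = refl
  caseLast-fromℕ {n = suc n} f a = caseLast-fromℕ (f ∘ suc) a

  module _ {n : ℕ} (A : Mat n n) (b c : Fin n → Carrier) (d : Carrier) where

    block-topLeft : ∀ i j → block A b c d (inject₁ i) (inject₁ j) ≡ A i j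
    block-topLeft i j = trans (cong (_$ inject₁ j) (caseLast-inject₁ (λ i → caseLast (A i) (b i)) (caseLast c d) i))
                              (caseLast-inject₁ (A i) (b i) j)

    block-topRight : ∀ i → block A b c d (inject₁ i) (fromℕ n) ≡ b i
    block-topRight i = trans (cong (_$ fromℕ n) (caseLast-inject₁ (λ i → caseLast (A i) (b i)) (caseLast c d) i)) (caseLast-fromℕ (A i) (b i))

    block-bottomLeft : ∀ j → block A b c d (fromℕ n) (inject₁ j) ≡ c j
    block-bottomLeft j = trans (cong (_$ inject₁ j) (caseLast-fromℕ (λ i → caseLast (A i) (b i)) (caseLast c d))) (caseLast-inject₁ c d j)

    block-bottomRight : block A b c d (fromℕ n) (fromℕ n) ≡ d
    block-bottomRight = trans (cong (_$ fromℕ n) (caseLast-fromℕ (λ i → caseLast (A i) (b i)) (caseLast c d))) (caseLast-fromℕ c d)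

  ≋-block : ∀ {n} (X : Mat (suc n) (suc n)) {A : Mat n n} {b c : Fin n → Carrier} {d : Carrier} →
            (∀ i j → X (inject₁ i) (inject₁ j) ≡ A i j) → (∀ i → X (inject₁ i) (fromℕ n) ≡ b i) →
            (∀ j → X (fromℕ n) (inject₁ j) ≡ c j) → X (fromℕ n) (fromℕ n) ≡ d → X ≋ block A b c d
  ≋-block X {A} {b} {c} {d} topLeft topRight bottomLeft bottomRight x y with view x | view y
  ... | ‵inject₁ i | ‵inject₁ j = trans (topLeft i j) (sym (block-topLeft A b c d i j))
  ... | ‵inject₁ i | ‵fromℕ     = trans (topRight i) (sym (block-topRight A b c d i))
  ... | ‵fromℕ     | ‵inject₁ j = trans (bottomLeft j) (sym (block-bottomLeft A b c d j))
  ... | ‵fromℕ     | ‵fromℕ     = trans bottomRight (sym (block-bottomRight A b c d))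

  block-cong : ∀ {n} {A A′ : Mat n n} {b b′ c c′ : Fin n → Carrier} {d d′ : Carrier} →
               A ≋ A′ → (∀ i → b i ≡ b′ i) → (∀ j → c j ≡ c′ j) → d ≡ d′ → block A b c d ≋ block A′ b′ c′ d′
  block-cong {A = A} {b = b} {c = c} {d = d} A≋A′ b≗b′ c≗c′ d≡d′ = ≋-block (block A b c d)
    (λ i j → trans (block-topLeft A b c d i j) (A≋A′ i j)) (λ i → trans (block-topRight A b c d i) (b≗b′ i))
    (λ j → trans (block-bottomLeft A b c d j) (c≗c′ j)) (trans (block-bottomRight A b c d) d≡d′)

  idM≋block : ∀ {n} → idM (suc n) ≋ block (idM n) (zeroV n) (zeroV n) 1#
  idM≋block {n} = ≋-block (idM (suc n)) topLeft
    (λ i → idM-offDiag (inject₁ i) (fromℕ n) (Data.Fin.Properties.fromℕ≢inject₁ ∘ sym))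
    (λ j → idM-offDiag (fromℕ n) (inject₁ j) Data.Fin.Properties.fromℕ≢inject₁) (idM-diag (fromℕ n))
    where
    topLeft : ∀ i j → idM (suc n) (inject₁ i) (inject₁ j) ≡ idM n i j
    topLeft i j with i Data.Fin.≟ j
    ... | yes refl = idM-diag (inject₁ i)
    ... | no i≢j   = idM-offDiag (inject₁ i) (inject₁ j) (i≢j ∘ Data.Fin.Properties.inject₁-injective)

  block-⊗ : ∀ {n} (A : Mat n n) b α (B : Mat n n) β γ →
            (block A b (zeroV n) α ⊗ block B β (zeroV n) γ) ≋
            block (A ⊗ B) (λ i → sumF n (λ l → A i l * β l) + b i * γ) (zeroV n) (α * γ)
  block-⊗ {n} A b α B β γ = ≋-block (X ⊗ Y) topLeft topRight bottomLeft bottomRight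
    where
    X = block A b (zeroV n) α
    Y = block B β (zeroV n) γ
    product : ∀ x y → (X ⊗ Y) x y ≡ sumF n (λ l → X x (inject₁ l) * Y (inject₁ l) y) + X x (fromℕ n) * Y (fromℕ n) y
    product x y = sumF-init-last (λ l → X x l * Y l y)
    bottomRow : ∀ y → sumF n (λ l → X (fromℕ n) (inject₁ l) * Y (inject₁ l) y) ≡ 0#
    bottomRow y = sumF-zero (λ l → trans (cong (_* _) (block-bottomLeft A b _ α l)) (zeroˡ _))
    topLeft : ∀ i j → (X ⊗ Y) (inject₁ i) (inject₁ j) ≡ (A ⊗ B) i j
    topLeft i j = begin
      (X ⊗ Y) (inject₁ i) (inject₁ j)                       ≡⟨ product _ _ ⟩
      sumF n (λ l → X (inject₁ i) (inject₁ l) * Y (inject₁ l) (inject₁ j)) + X (inject₁ i) (fromℕ n) * Y (fromℕ n) (inject₁ j)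
        ≡⟨ cong₂ _+_ (sumF-cong (λ l → cong₂ _*_ (block-topLeft A b _ α i l) (block-topLeft B β _ γ l j)))
                     (cong₂ _*_ (block-topRight A b _ α i) (block-bottomLeft B β _ γ j)) ⟩
      (A ⊗ B) i j + b i * 0#                                ≡⟨ cong ((A ⊗ B) i j +_) (zeroʳ (b i)) ⟩
      (A ⊗ B) i j + 0#                                      ≡⟨ +-identityʳ _ ⟩
      (A ⊗ B) i j                                           ∎
      where open ≡-Reasoning
    topRight : ∀ i → (X ⊗ Y) (inject₁ i) (fromℕ n) ≡ sumF n (λ l → A i l * β l) + b i * γ
    topRight i = trans (product _ _)
      (cong₂ _+_ (sumF-cong (λ l → cong₂ _*_ (block-topLeft A b _ α i l) (block-topRight B β _ γ l)))
                 (cong₂ _*_ (block-topRight A b _ α i) (block-bottomRight B β _ γ)))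
    bottomLeft : ∀ j → (X ⊗ Y) (fromℕ n) (inject₁ j) ≡ 0#
    bottomLeft j = trans (product _ _) (trans (cong₂ _+_ (bottomRow _) (cong (_ *_) (block-bottomLeft B β _ γ j)))
                                              (trans (+-identityˡ _) (zeroʳ _)))
    bottomRight : (X ⊗ Y) (fromℕ n) (fromℕ n) ≡ α * γ
    bottomRight = trans (product _ _) (trans (cong₂ _+_ (bottomRow _)
                    (cong₂ _*_ (block-bottomRight A b _ α) (block-bottomRight B β _ γ))) (+-identityˡ _))

  UpperTri-block : ∀ {n} {A : Mat n n} → UpperTri A → ∀ b d → UpperTri (block A b (zeroV n) d)
  UpperTri-block {n} {A} A-ut b d x y y<x with view x | view y
  ... | ‵inject₁ i | ‵inject₁ j = trans (block-topLeft A b _ d i j)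
        (A-ut i j (subst₂ _<_ (toℕ-inject₁ j) (toℕ-inject₁ i) y<x))
  ... | ‵inject₁ i | ‵fromℕ     = ⊥-elim (ℕ.<-asym y<x (subst₂ _<_ (sym (toℕ-inject₁ i)) (sym (toℕ-fromℕ n)) (toℕ<n i)))
  ... | ‵fromℕ     | ‵inject₁ j = block-bottomLeft A b _ d j
  ... | ‵fromℕ     | ‵fromℕ     = ⊥-elim (ℕ.<-irrefl refl y<x)

  extend : ∀ {n} → Mat n n → Vector Carrier n → Mat (suc n) (suc n)
  extend {n} N b = block N b (zeroV n) 0#

  pow-extend : ∀ {n} (N : Mat n n) b k →
               pow (extend N b) (suc k) ≋ extend (pow N (suc k)) (λ i → sumF n (λ l → pow N k i l * b l))
  pow-extend {n} N b zero = ≋-trans (⊗-identityʳ (extend N b))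
    (block-cong (≋-sym (⊗-identityʳ N)) (λ i → sym (sumF-idMˡ i b)) (λ _ → refl) refl)
  pow-extend {n} N b (suc k) = begin
    extend N b ⊗ pow (extend N b) (suc k)              ≈⟨ ⊗-congˡ (extend N b) (pow-extend N b k) ⟩
    extend N b ⊗ extend (pow N (suc k)) (Nᵏb)          ≈⟨ block-⊗ N b 0# (pow N (suc k)) Nᵏb 0# ⟩
    block (N ⊗ pow N (suc k)) _ (zeroV n) (0# * 0#)    ≈⟨ block-cong ≋-refl Nᵏ⁺¹b (λ _ → refl) (zeroˡ 0#) ⟩
    extend (pow N (suc (suc k))) (λ i → sumF n (λ l → pow N (suc k) i l * b l)) ∎
    where
    open ≋-Reasoning
    Nᵏb = λ i → sumF n (λ l → pow N k i l * b l)
    -- associativity of ⊗, with b read as an n × 1 matrix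
    Nᵏ⁺¹b : ∀ i → sumF n (λ l → N i l * Nᵏb l) + b i * 0# ≡ sumF n (λ l → pow N (suc k) i l * b l)
    Nᵏ⁺¹b i = trans (cong₂ _+_ (sym (⊗-assoc N (pow N k) (λ m (_ : Fin 1) → b m) i zero)) (zeroʳ (b i))) (+-identityʳ _)

  Uo-extend : ∀ {n} {N : Mat n n} → Uo n N → ∀ b → Uo (suc n) (extend N b)
  Uo-extend {n} {N} (N-ut , k , Nᵏ≋0) b = UpperTri-block N-ut b 0# , suc k ,
    ≋-trans (pow-extend N b k) (≋-sym (≋-block (zeroM (suc n) (suc n))
      (λ i j → sym (sumF-zero (λ l → trans (cong (N i l *_) (Nᵏ≋0 l j)) (zeroʳ _))))
      (λ i → sym (sumF-zero (λ l → trans (cong (_* b l) (Nᵏ≋0 i l)) (zeroˡ _))))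
      (λ _ → refl) refl))

  top-extend : ∀ {n} (N : Mat n n) b → Conj n (top (extend N b)) N
  top-extend {n} N b = ≋⇒Conj (block-topLeft N b (zeroV n) 0#)

  lincomb : ∀ {m r} → (Fin r → Vector Carrier m) → Vector Carrier r → Vector Carrier m
  lincomb {r = r} us c i = sumF r (λ l → c l * us l i)

  Span : ∀ {m r} → (Fin r → Vector Carrier m) → Vector Carrier m → Set
  Span us w = ∃ λ c → ∀ i → w i ≡ lincomb us c i

  Independent : ∀ {m r} → (Fin r → Vector Carrier m) → Set
  Independent us = ∀ c → (∀ i → lincomb us c i ≡ 0#) → ∀ l → c l ≡ 0#

  columns : ∀ {m n} → Mat m n → Fin n → Vector Carrier m
  columns A l i = A i l

  AffineRelated : ∀ {m} → (Carrier → Set) → (Vector Carrier m → Set) → Vector Carrier m → Vector Carrier m → Set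
  AffineRelated K S b b′ = ∃ λ k → K k × ∃ λ w → S w × (∀ i → b′ i ≡ k * b i + w i)

  Congruent : ∀ {m} → (Vector Carrier m → Set) → Vector Carrier m → Vector Carrier m → Set
  Congruent = AffineRelated (_≡ 1#)

  ScaledCongruent : ∀ {m} → (Vector Carrier m → Set) → Vector Carrier m → Vector Carrier m → Set
  ScaledCongruent = AffineRelated (_≢ 0#)

  bangMatrix : ∀ {n} → Vector Carrier n → Carrier → Mat (suc n) (suc n)
  bangMatrix {n} c k = block (idM n) c (zeroV n) k

  BangConj-extend⇒ScaledCongruent : ∀ {n} (N : Mat n n) {b b′} →
    BangConj (extend N b) (extend N b′) → ScaledCongruent (Span (columns N)) b b′
  BangConj-extend⇒ScaledCongruent {n} N {b} {b′} (c , k , k≢0 , C , BC≋I , CB≋I , conj) =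
    k , k≢0 , lincomb (columns N) c , (c , λ _ → refl) , b′≡kb+Nc
    where
    lastColumn : ∀ i → (bangMatrix c k ⊗ extend N b′) (inject₁ i) (fromℕ n) ≡ (extend N b ⊗ bangMatrix c k) (inject₁ i) (fromℕ n)
    lastColumn i = ConjBy-intertwines {B = bangMatrix c k} {C} {extend N b} {extend N b′} BC≋I conj (inject₁ i) (fromℕ n)
    b′≡kb+Nc : ∀ i → b′ i ≡ k * b i + lincomb (columns N) c i
    b′≡kb+Nc i = begin
      b′ i                                        ≡⟨ sumF-idMˡ i b′ ⟨
      sumF n (λ l → idM n i l * b′ l)             ≡⟨ +-identityʳ _ ⟨
      sumF n (λ l → idM n i l * b′ l) + 0#        ≡⟨ cong (sumF n (λ l → idM n i l * b′ l) +_) (zeroʳ (c i)) ⟨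
      sumF n (λ l → idM n i l * b′ l) + c i * 0#  ≡⟨ trans (block-⊗ (idM n) c k N b′ 0# (inject₁ i) (fromℕ n)) (block-topRight _ _ _ _ i) ⟨
      (bangMatrix c k ⊗ extend N b′) (inject₁ i) (fromℕ n) ≡⟨ lastColumn i ⟩
      (extend N b ⊗ bangMatrix c k) (inject₁ i) (fromℕ n)
        ≡⟨ trans (block-⊗ N b 0# (idM n) c k (inject₁ i) (fromℕ n)) (block-topRight _ _ _ _ i) ⟩
      sumF n (λ l → N i l * c l) + b i * k        ≡⟨ +-comm _ _ ⟩
      b i * k + sumF n (λ l → N i l * c l)        ≡⟨ cong₂ _+_ (*-comm (b i) k) (sumF-cong (λ l → *-comm (N i l) (c l))) ⟩
      k * b i + lincomb (columns N) c i           ∎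
      where open ≡-Reasoning

  bangMatrix-⊗ : ∀ {n} (c : Vector Carrier n) k c′ k′ →
                 (bangMatrix c k ⊗ bangMatrix c′ k′) ≋ bangMatrix (λ i → c′ i + c i * k′) (k * k′)
  bangMatrix-⊗ {n} c k c′ k′ = ≋-trans (block-⊗ (idM n) c k (idM n) c′ k′)
    (block-cong (⊗-identityˡ (idM n)) (λ i → cong (_+ c i * k′) (sumF-idMˡ i c′)) (λ _ → refl) refl)

  bangMatrix-inverse : ∀ {n} (c : Vector Carrier n) k (k≢0 : k ≢ 0#) →
    let c⁻¹ = λ i → - (c i * inv k k≢0) in
    (bangMatrix c k ⊗ bangMatrix c⁻¹ (inv k k≢0)) ≋ idM (suc n) × (bangMatrix c⁻¹ (inv k k≢0) ⊗ bangMatrix c k) ≋ idM (suc n)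
  bangMatrix-inverse {n} c k k≢0 =
    ≋-trans (bangMatrix-⊗ c k _ k⁻¹)
      (≋-trans (block-cong ≋-refl (λ i → -‿inverseˡ (c i * k⁻¹)) (λ _ → refl) (inv-r k k≢0)) (≋-sym idM≋block)) ,
    ≋-trans (bangMatrix-⊗ _ k⁻¹ c k) (≋-trans (block-cong ≋-refl c-cancels (λ _ → refl) (inv-l k k≢0)) (≋-sym idM≋block))
    where
    k⁻¹ = inv k k≢0
    c-cancels : ∀ i → c i + - (c i * k⁻¹) * k ≡ 0#
    c-cancels i = begin
      c i + - (c i * k⁻¹) * k    ≡⟨ cong (c i +_) (-‿distribˡ-* _ k) ⟨
      c i + - (c i * k⁻¹ * k)    ≡⟨ cong (λ x → c i + - x) (trans (*-assoc (c i) k⁻¹ k) (cong (c i *_) (inv-l k k≢0))) ⟩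
      c i + - (c i * 1#)         ≡⟨ cong (λ x → c i + - x) (*-identityʳ (c i)) ⟩
      c i + - c i                ≡⟨ -‿inverseʳ (c i) ⟩
      0#                         ∎
      where open ≡-Reasoning

  ScaledCongruent⇒BangConj-extend : ∀ {n} (N : Mat n n) {b b′} →
    ScaledCongruent (Span (columns N)) b b′ → BangConj (extend N b) (extend N b′)
  ScaledCongruent⇒BangConj-extend {n} N {b} {b′} (k , k≢0 , w , (c , w≡Nc) , b′≡kb+w) =
    c , k , k≢0 , bangMatrix c⁻¹ k⁻¹ , proj₁ inverse , proj₂ inverse , (begin
      (bangMatrix c⁻¹ k⁻¹ ⊗ extend N b) ⊗ bangMatrix c k    ≈⟨ ⊗-congʳ (bangMatrix c k) fixes-extend ⟩
      extend N b ⊗ bangMatrix c k                          ≈⟨ block-⊗ N b 0# (idM n) c k ⟩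
      block (N ⊗ idM n) _ (zeroV n) (0# * k)               ≈⟨ block-cong (⊗-identityʳ N) (λ i → sym (b′≡ i)) (λ _ → refl) (zeroˡ k) ⟩
      extend N b′                                          ∎)
    where
    open ≋-Reasoning
    k⁻¹ = inv k k≢0
    c⁻¹ = λ i → - (c i * k⁻¹)
    inverse = bangMatrix-inverse c k k≢0
    fixes-extend : (bangMatrix c⁻¹ k⁻¹ ⊗ extend N b) ≋ extend N b
    fixes-extend = ≋-trans (block-⊗ (idM n) c⁻¹ k⁻¹ N b 0#)
      (block-cong (⊗-identityˡ N) (λ i → trans (cong₂ _+_ (sumF-idMˡ i b) (zeroʳ _)) (+-identityʳ (b i))) (λ _ → refl) (zeroʳ k⁻¹))
    b′≡ : ∀ i → b′ i ≡ sumF n (λ l → N i l * c l) + b i * k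
    b′≡ i = trans (b′≡kb+w i) (trans (cong₂ _+_ (*-comm k (b i)) (trans (w≡Nc i) (sumF-cong (λ l → *-comm (c l) (N i l))))) (+-comm _ _))

  BangConj⇒Conj : ∀ {n} {M M′ : Mat (suc n) (suc n)} → BangConj M M′ → Conj (suc n) M M′
  BangConj⇒Conj (c , k , _ , conjugation) = bangMatrix c k , UpperTri-block UpperTri-idM c k , conjugation

  module _ {m r : ℕ} (us : Fin r → Vector Carrier m) where

    Span-zero : Span us (λ _ → 0#)
    Span-zero = (λ _ → 0#) , λ i → sym (sumF-zero (λ l → zeroˡ (us l i)))

    Span-+ : ∀ {w w′} → Span us w → Span us w′ → Span us (λ i → w i + w′ i)
    Span-+ {w} {w′} (c , w≡) (c′ , w′≡) = (λ l → c l + c′ l) , λ i → begin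
      w i + w′ i                                     ≡⟨ cong₂ _+_ (w≡ i) (w′≡ i) ⟩
      lincomb us c i + lincomb us c′ i               ≡⟨ sumF-+ {r} _ _ ⟨
      sumF r (λ l → c l * us l i + c′ l * us l i)    ≡⟨ sumF-cong (λ l → distribʳ (us l i) (c l) (c′ l)) ⟨
      lincomb us (λ l → c l + c′ l) i                ∎
      where open ≡-Reasoning

    Span-scale : ∀ k {w} → Span us w → Span us (λ i → k * w i)
    Span-scale k {w} (c , w≡) = (λ l → k * c l) , λ i → begin
      k * w i                              ≡⟨ cong (k *_) (w≡ i) ⟩
      k * lincomb us c i                   ≡⟨ *-distribˡ-sumF {r} k _ ⟩
      sumF r (λ l → k * (c l * us l i))    ≡⟨ sumF-cong (λ l → *-assoc k (c l) (us l i)) ⟨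
      lincomb us (λ l → k * c l) i         ∎
      where open ≡-Reasoning

    Span-member : ∀ l → Span us (us l)
    Span-member l = idM r l , λ i → sym (sumF-idMˡ l (λ l′ → us l′ i))

    Span-resp : ∀ {w w′} → (∀ i → w i ≡ w′ i) → Span us w → Span us w′
    Span-resp w≗w′ (c , w≡) = c , λ i → trans (sym (w≗w′ i)) (w≡ i)

    Span-lincomb : ∀ {n} (vs : Fin n → Vector Carrier m) → (∀ j → Span us (vs j)) → ∀ c → Span us (lincomb vs c)
    Span-lincomb {zero}  vs vs∈ c = Span-zero
    Span-lincomb {suc n} vs vs∈ c = Span-+ (Span-scale (c zero) (vs∈ zero)) (Span-lincomb (vs ∘ suc) (vs∈ ∘ suc) (c ∘ suc))

    Span-⊆ : ∀ {n} {vs : Fin n → Vector Carrier m} → (∀ j → Span us (vs j)) → ∀ {w} → Span vs w → Span us w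
    Span-⊆ {vs = vs} vs∈ (c , w≡) = Span-resp (sym ∘ w≡) (Span-lincomb vs vs∈ c)

    ScaledCongruent-sym : ∀ {b b′} → ScaledCongruent (Span us) b b′ → ScaledCongruent (Span us) b′ b
    ScaledCongruent-sym {b} {b′} (k , k≢0 , w , w∈ , b′≡) =
      k⁻¹ , inv≢0 k k≢0 , (λ i → - k⁻¹ * w i) , Span-scale (- k⁻¹) w∈ , λ i → sym (begin
        k⁻¹ * b′ i + - k⁻¹ * w i                 ≡⟨ cong (λ x → k⁻¹ * x + - k⁻¹ * w i) (b′≡ i) ⟩
        k⁻¹ * (k * b i + w i) + - k⁻¹ * w i      ≡⟨ cong (_+ - k⁻¹ * w i) (distribˡ k⁻¹ _ _) ⟩
        k⁻¹ * (k * b i) + k⁻¹ * w i + - k⁻¹ * w i ≡⟨ +-assoc _ _ _ ⟩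
        k⁻¹ * (k * b i) + (k⁻¹ * w i + - k⁻¹ * w i)
          ≡⟨ cong₂ _+_ (inv-*-cancel k k≢0 (b i))
                       (trans (sym (distribʳ (w i) k⁻¹ (- k⁻¹))) (trans (cong (_* w i) (-‿inverseʳ k⁻¹)) (zeroˡ _))) ⟩
        b i + 0#                                 ≡⟨ +-identityʳ (b i) ⟩
        b i                                      ∎)
      where
      open ≡-Reasoning
      k⁻¹ = inv k k≢0

    ScaledCongruent-trans : ∀ {b b′ b″} → ScaledCongruent (Span us) b b′ → ScaledCongruent (Span us) b′ b″ →
                            ScaledCongruent (Span us) b b″
    ScaledCongruent-trans {b} {b′} {b″} (k , k≢0 , w , w∈ , b′≡) (k′ , k′≢0 , w′ , w′∈ , b″≡) =
      k′ * k , *-nonzero k′≢0 k≢0 , (λ i → k′ * w i + w′ i) , Span-+ (Span-scale k′ w∈) w′∈ , λ i → begin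
        b″ i                               ≡⟨ b″≡ i ⟩
        k′ * b′ i + w′ i                   ≡⟨ cong (λ x → k′ * x + w′ i) (b′≡ i) ⟩
        k′ * (k * b i + w i) + w′ i        ≡⟨ cong (_+ w′ i) (distribˡ k′ _ _) ⟩
        k′ * (k * b i) + k′ * w i + w′ i   ≡⟨ +-assoc _ _ _ ⟩
        k′ * (k * b i) + (k′ * w i + w′ i) ≡⟨ cong (_+ (k′ * w i + w′ i)) (*-assoc k′ k (b i)) ⟨
        k′ * k * b i + (k′ * w i + w′ i)   ∎
      where open ≡-Reasoning

  AffineRelated-mono : ∀ {m} {K : Carrier → Set} {S S′ : Vector Carrier m → Set} → (∀ {w} → S w → S′ w) →
                       ∀ {b b′} → AffineRelated K S b b′ → AffineRelated K S′ b b′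
  AffineRelated-mono S⊆S′ (k , Kk , w , w∈S , b′≡) = k , Kk , w , S⊆S′ w∈S , b′≡

  Transversal : ∀ {X : Set} → (X → X → Set) → ℕ → Set
  Transversal R d = HasOrbitCount (λ _ → ⊤) R d

  module _ {X : Set} {R : X → X → Set} where

    HasOrbitCount-respRel : ∀ {S : X → Set} {R′ : X → X → Set} {d} → (∀ {x y} → R x y → R′ x y) → (∀ {x y} → R′ x y → R x y) →
                            HasOrbitCount S R d → HasOrbitCount S R′ d
    HasOrbitCount-respRel R⇒R′ R′⇒R (rep , rep∈S , rep-injective , covers) =
      rep , rep∈S , (λ a a′ → rep-injective a a′ ∘ R′⇒R) , λ x x∈S → let (a , r) = covers x x∈S in a , R⇒R′ r

    HasOrbitCount-respSet : ∀ {S S′ : X → Set} {d} → (∀ {x} → S x → S′ x) → (∀ {x} → S′ x → S x) →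
                            HasOrbitCount S R d → HasOrbitCount S′ R d
    HasOrbitCount-respSet S⇒S′ S′⇒S (rep , rep∈S , rep-injective , covers) =
      rep , S⇒S′ ∘ rep∈S , rep-injective , λ x → covers x ∘ S′⇒S

    HasOrbitCount⇒Transversal : ∀ {S : X → Set} {d} → (∀ x → S x) → HasOrbitCount S R d → Transversal R d
    HasOrbitCount⇒Transversal everywhere (rep , _ , rep-injective , covers) =
      rep , (λ _ → tt) , rep-injective , λ x _ → covers x (everywhere x)

    HasOrbitCount-transfer : ∀ {Y : Set} {R′ : Y → Y → Set} {S : X → Set} {d} (ι : Y → X) →
      (∀ y → S (ι y)) → (∀ {y y′} → R (ι y) (ι y′) → R′ y y′) →
      (∀ {x} → S x → ∃ λ y′ → ∀ {y} → R′ y y′ → R (ι y) x) →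
      Transversal R′ d → HasOrbitCount S R d
    HasOrbitCount-transfer ι ι∈S reflect lift (rep , _ , rep-injective , covers) =
      ι ∘ rep , ι∈S ∘ rep , (λ a a′ → rep-injective a a′ ∘ reflect) ,
      λ x x∈S → let (y′ , lifts) = lift x∈S ; (a , r) = covers y′ tt in a , lifts r

    HasOrbitCount-∪ : ∀ {S T : X → Set} {d₁ d₂} → HasOrbitCount S R d₁ → HasOrbitCount T R d₂ →
      (∀ {x y} → S x → T y → ¬ R x y) → (∀ {x y} → T x → S y → ¬ R x y) →
      HasOrbitCount (λ x → S x ⊎ T x) R (d₁ Data.Nat.+ d₂)
    HasOrbitCount-∪ {S} {T} {d₁} {d₂} (rep₁ , rep₁∈S , rep₁-injective , covers₁)
                                      (rep₂ , rep₂∈T , rep₂-injective , covers₂) S↮T T↮S =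
      pick ∘ splitAt d₁ , pick∈ ∘ splitAt d₁ , rep-injective , covers
      where
      pick : Fin d₁ ⊎ Fin d₂ → X
      pick = [ rep₁ , rep₂ ]′
      pick∈ : ∀ s → S (pick s) ⊎ T (pick s)
      pick∈ (inj₁ a) = inj₁ (rep₁∈S a)
      pick∈ (inj₂ a) = inj₂ (rep₂∈T a)
      pick-injective : ∀ s s′ → R (pick s) (pick s′) → s ≡ s′
      pick-injective (inj₁ a) (inj₁ a′) r = cong inj₁ (rep₁-injective a a′ r)
      pick-injective (inj₁ a) (inj₂ a′) r = ⊥-elim (S↮T (rep₁∈S a) (rep₂∈T a′) r)
      pick-injective (inj₂ a) (inj₁ a′) r = ⊥-elim (T↮S (rep₂∈T a) (rep₁∈S a′) r)
      pick-injective (inj₂ a) (inj₂ a′) r = cong inj₂ (rep₂-injective a a′ r)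
      rep-injective : ∀ a a′ → R (pick (splitAt d₁ a)) (pick (splitAt d₁ a′)) → a ≡ a′
      rep-injective a a′ r = begin
        a                           ≡⟨ join-splitAt d₁ d₂ a ⟨
        join d₁ d₂ (splitAt d₁ a)   ≡⟨ cong (join d₁ d₂) (pick-injective (splitAt d₁ a) (splitAt d₁ a′) r) ⟩
        join d₁ d₂ (splitAt d₁ a′)  ≡⟨ join-splitAt d₁ d₂ a′ ⟩
        a′                          ∎
        where open ≡-Reasoning
      covers-pick : ∀ x s → R (pick s) x → ∃ λ a → R (pick (splitAt d₁ a)) x
      covers-pick x s r = join d₁ d₂ s , subst (λ s′ → R (pick s′) x) (sym (splitAt-join d₁ d₂ s)) r
      covers : ∀ x → S x ⊎ T x → ∃ λ a → R (pick (splitAt d₁ a)) x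
      covers x (inj₁ x∈S) = let (a , r) = covers₁ x x∈S in covers-pick x (inj₁ a) r
      covers x (inj₂ x∈T) = let (a , r) = covers₂ x x∈T in covers-pick x (inj₂ a) r

    HasOrbitCount-⋃ : ∀ i (S : Fin i → X → Set) (d : Fin i → ℕ) → (∀ j → HasOrbitCount (S j) R (d j)) →
      (∀ {j j′ x y} → S j x → S j′ y → R x y → j ≡ j′) →
      HasOrbitCount (λ x → ∃ λ j → S j x) R (sumℕ i d)
    HasOrbitCount-⋃ zero    S d counts separated = (λ ()) , (λ ()) , (λ ()) , λ { x (() , _) }
    HasOrbitCount-⋃ (suc i) S d counts separated =
      HasOrbitCount-respSet [ (zero ,_) , (λ (j , x∈) → suc j , x∈) ]′ split
        (HasOrbitCount-∪ (counts zero) rest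
          (λ x∈ (j , y∈) r → 0≢suc (separated x∈ y∈ r)) (λ (j , x∈) y∈ r → 0≢suc (sym (separated x∈ y∈ r))))
      where
      rest : HasOrbitCount (λ x → ∃ λ j → S (suc j) x) R (sumℕ i (d ∘ suc))
      rest = HasOrbitCount-⋃ i (S ∘ suc) (d ∘ suc) (counts ∘ suc) (λ x∈ y∈ r → suc-injective (separated x∈ y∈ r))
      split : ∀ {x} → (∃ λ j → S j x) → S zero x ⊎ (∃ λ j → S (suc j) x)
      split (zero  , x∈) = inj₁ x∈
      split (suc j , x∈) = inj₂ (j , x∈)
      0≢suc : ∀ {j : Fin i} → zero ≢ suc j
      0≢suc ()

    module _ (R-sym : ∀ {x y} → R x y → R y x) (R-trans : ∀ {x y z} → R x y → R y z → R x z) where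

      Transversal-≤ : ∀ {d d′} → Transversal R d → Transversal R d′ → d ≤ d′
      Transversal-≤ {d} (rep , _ , rep-injective , _) (rep′ , _ , _ , covers′) = injective⇒≤ {f = class} class-injective
        where
        class : Fin d → Fin _
        class a = proj₁ (covers′ (rep a) tt)
        class-injective : ∀ {a a′} → class a ≡ class a′ → a ≡ a′
        class-injective {a} {a′} same = rep-injective a a′ (R-trans (R-sym (proj₂ (covers′ (rep a) tt)))
          (subst (λ c → R (rep′ c) (rep a′)) (sym same) (proj₂ (covers′ (rep a′) tt))))

      Transversal-size-unique : ∀ {d d′} → Transversal R d → Transversal R d′ → d ≡ d′
      Transversal-size-unique T T′ = ℕ.≤-antisym (Transversal-≤ T T′) (Transversal-≤ T′ T)

  Transversal-singleton : ∀ {X : Set} {R : X → X → Set} (x : X) → (∀ y → R x y) → Transversal R 1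
  Transversal-singleton x related = (λ _ → x) , (λ _ → tt) , (λ { zero zero _ → refl }) , λ y _ → zero , related y

  module _ {m r r′ : ℕ} {us : Fin r → Vector Carrier (suc m)} {us′ : Fin r′ → Vector Carrier m}
           (Span-tail : ∀ {w} → Span us w → w zero ≡ 0# → Span us′ (tail w))
           (Span-cons : ∀ {w′} → Span us′ w′ → Span us (0# ∷ w′)) where

    AffineRelated-tail₀ : ∀ {K y y′} → AffineRelated K (Span us) (0# ∷ y) (0# ∷ y′) → AffineRelated K (Span us′) y y′
    AffineRelated-tail₀ (k , Kk , w , w∈ , eq) = k , Kk , tail w , Span-tail w∈ w₀≡0 , eq ∘ suc
      where
      w₀≡0 : w zero ≡ 0#
      w₀≡0 = sym (trans (eq zero) (trans (cong (_+ w zero) (zeroʳ k)) (+-identityˡ (w zero))))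

    AffineRelated-0∷ : ∀ {K y z v x} → Span us v → (∀ i → x i ≡ (0# ∷ z) i + v i) →
                         AffineRelated K (Span us′) y z → AffineRelated K (Span us) (0# ∷ y) x
    AffineRelated-0∷ {y = y} {z} {v} {x} v∈ x≡ (k , Kk , w′ , w′∈ , z≡) =
      k , Kk , (λ i → (0# ∷ w′) i + v i) , Span-+ us (Span-cons w′∈) v∈ , x≡ky+w
      where
      open ≡-Reasoning
      x≡ky+w : ∀ i → x i ≡ k * (0# ∷ y) i + ((0# ∷ w′) i + v i)
      x≡ky+w zero = begin
        x zero                  ≡⟨ x≡ zero ⟩
        0# + v zero             ≡⟨ cong (_+ v zero) (trans (sym (+-identityˡ 0#)) (cong (_+ 0#) (sym (zeroʳ k)))) ⟩
        k * 0# + 0# + v zero    ≡⟨ +-assoc _ 0# (v zero) ⟩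
        k * 0# + (0# + v zero)  ∎
      x≡ky+w (suc i) = begin
        x (suc i)                    ≡⟨ x≡ (suc i) ⟩
        z i + v (suc i)              ≡⟨ cong (_+ v (suc i)) (z≡ i) ⟩
        k * y i + w′ i + v (suc i)   ≡⟨ +-assoc _ _ _ ⟩
        k * y i + (w′ i + v (suc i)) ∎

    Transversal-reduce : ∀ {K d} → (∀ x → ∃ λ z → ∃ λ v → Span us v × (∀ i → x i ≡ (0# ∷ z) i + v i)) →
      Transversal (AffineRelated K (Span us′)) d → Transversal (AffineRelated K (Span us)) d
    Transversal-reduce {K} decompose =
      HasOrbitCount-transfer {R = AffineRelated K (Span us)} {R′ = AffineRelated K (Span us′)} (0# ∷_) (λ _ → tt) AffineRelated-tail₀
      λ {x} _ → let (z , v , v∈ , x≡) = decompose x in z , AffineRelated-0∷ v∈ x≡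

  record QuotientCounts {m r : ℕ} (us : Fin r → Vector Carrier m) : Set where
    field
      rank≤dim     : r ≤ m
      cosets       : Transversal (Congruent (Span us)) (q ^ (m ∸ r))
      scaledCosets : Transversal (ScaledCongruent (Span us)) (suc (geometricSum q (m ∸ r)))

  quotientCounts-dim0 : ∀ {r} (us : Fin r → Vector Carrier 0) → Independent us → QuotientCounts us
  quotientCounts-dim0 {zero} us _ = record
    { rank≤dim     = z≤n
    ; cosets       = Transversal-singleton {R = Congruent (Span us)} (λ ()) (λ _ → 1# , refl , (λ ()) , ((λ ()) , λ ()) , λ ())
    ; scaledCosets = Transversal-singleton {R = ScaledCongruent (Span us)} (λ ()) (λ _ → 1# , 1≢0 , (λ ()) , ((λ ()) , λ ()) , λ ())
    }
  quotientCounts-dim0 {suc r} us independent = ⊥-elim (1≢0 (independent (λ _ → 1#) (λ ()) zero))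

  enum-injective : ∀ {a a′} → enum a ≡ enum a′ → a ≡ a′
  enum-injective {a} {a′} eq = trans (sym (index-enum a)) (trans (cong index eq) (index-enum a′))

  module ZeroFirstCoordinate {m r : ℕ} (us : Fin r → Vector Carrier (suc m)) (us₀≡0 : ∀ l → us l zero ≡ 0#) where

    tails : Fin r → Vector Carrier m
    tails l = tail (us l)

    lincomb-head : ∀ c → lincomb us c zero ≡ 0#
    lincomb-head c = sumF-zero (λ l → trans (cong (c l *_) (us₀≡0 l)) (zeroʳ (c l)))

    Span-head : ∀ {w} → Span us w → w zero ≡ 0#
    Span-head (c , w≡) = trans (w≡ zero) (lincomb-head c)

    Span-cons : ∀ {w′} → Span tails w′ → Span us (0# ∷ w′)
    Span-cons (c , w′≡) = c , λ { zero → sym (lincomb-head c) ; (suc i) → w′≡ i }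

    independent : Independent us → Independent tails
    independent us-independent c combination≡0 = us-independent c λ { zero → lincomb-head c ; (suc i) → combination≡0 i }

    AffineRelated-tail : ∀ {K x x′} → AffineRelated K (Span us) x x′ → AffineRelated K (Span tails) (tail x) (tail x′)
    AffineRelated-tail (k , Kk , w , (c , w≡) , x′≡) = k , Kk , tail w , (c , w≡ ∘ suc) , x′≡ ∘ suc

    AffineRelated-head : ∀ {K x x′} → AffineRelated K (Span us) x x′ → ∃ λ k → K k × x′ zero ≡ k * x zero
    AffineRelated-head {x = x} (k , Kk , w , w∈ , x′≡) =
      k , Kk , trans (x′≡ zero) (trans (cong (k * x zero +_) (Span-head w∈)) (+-identityʳ _))

    AffineRelated-∷ : ∀ {K x₀ y x} (related : AffineRelated K (Span tails) y (tail x)) → x zero ≡ proj₁ related * x₀ →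
                      AffineRelated K (Span us) (x₀ ∷ y) x
    AffineRelated-∷ (k , Kk , w′ , w′∈ , eq) head≡ =
      k , Kk , 0# ∷ w′ , Span-cons w′∈ , λ { zero → trans head≡ (sym (+-identityʳ _)) ; (suc i) → eq i }

    cosets : ∀ {d} → Transversal (Congruent (Span tails)) d → Transversal (Congruent (Span us)) (q Data.Nat.* d)
    cosets {d} (rep′ , _ , rep′-injective , covers′) = rep , (λ _ → tt) , rep-injective , covers
      where
      rep : Fin (q Data.Nat.* d) → Vector Carrier (suc m)
      rep a = let (x₀ , y) = remQuot d a in enum x₀ ∷ rep′ y
      rep-injective : ∀ a a′ → Congruent (Span us) (rep a) (rep a′) → a ≡ a′
      rep-injective a a′ related = begin
        a                                   ≡⟨ combine-remQuot {q} d a ⟨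
        uncurry combine (remQuot {q} d a)   ≡⟨ cong₂ combine heads≡ (rep′-injective _ _ (AffineRelated-tail related)) ⟩
        uncurry combine (remQuot {q} d a′)  ≡⟨ combine-remQuot {q} d a′ ⟩
        a′                                  ∎
        where
        open ≡-Reasoning
        heads≡ : proj₁ (remQuot d a) ≡ proj₁ (remQuot d a′)
        heads≡ = let (k , k≡1 , head≡) = AffineRelated-head related in
          enum-injective (sym (trans head≡ (trans (cong (_* _) k≡1) (*-identityˡ _))))
      covers : ∀ x → ⊤ → ∃ λ a → Congruent (Span us) (rep a) x
      covers x _ = let (y , related) = covers′ (tail x) tt in
        combine (index (x zero)) y ,
        subst (λ s → Congruent (Span us) (enum (proj₁ s) ∷ rep′ (proj₂ s)) x) (sym (remQuot-combine (index (x zero)) y))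
          (AffineRelated-∷ related (sym (trans (cong (_* _) (proj₁ (proj₂ related))) (trans (*-identityˡ _) (enum-index (x zero))))))

    -- A vector with head 0 is related only to such vectors, and these are classified by their
    -- tails; a vector with nonzero head can be scaled to head 1, after which only plain
    -- congruence of the tails remains.
    scaledCosets : ∀ {d d′} → Transversal (Congruent (Span tails)) d → Transversal (ScaledCongruent (Span tails)) d′ →
                   Transversal (ScaledCongruent (Span us)) (d′ Data.Nat.+ d)
    scaledCosets cosets′ scaledCosets′ =
      HasOrbitCount⇒Transversal {R = ScaledCongruent (Span us)} zero-or-not
        (HasOrbitCount-∪ {R = ScaledCongruent (Span us)} zeroHead nonzeroHead zero↮nonzero nonzero↮zero)
      where
      ZeroHead NonzeroHead : Vector Carrier (suc m) → Set
      ZeroHead x = x zero ≡ 0#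
      NonzeroHead x = x zero ≢ 0#

      zero-or-not : ∀ x → ZeroHead x ⊎ NonzeroHead x
      zero-or-not x with x zero ≟ 0#
      ... | yes x₀≡0 = inj₁ x₀≡0
      ... | no  x₀≢0 = inj₂ x₀≢0

      zeroHead : HasOrbitCount ZeroHead (ScaledCongruent (Span us)) _
      zeroHead = HasOrbitCount-transfer {R = ScaledCongruent (Span us)} (0# ∷_) (λ _ → refl) AffineRelated-tail
        (λ {x} x₀≡0 → tail x , λ related → AffineRelated-∷ related (trans x₀≡0 (sym (zeroʳ _)))) scaledCosets′

      nonzeroHead : HasOrbitCount NonzeroHead (ScaledCongruent (Span us)) _
      nonzeroHead = HasOrbitCount-transfer {R = ScaledCongruent (Span us)} (1# ∷_) (λ _ → 1≢0) reflect lift cosets′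
        where
        reflect : ∀ {y y′} → ScaledCongruent (Span us) (1# ∷ y) (1# ∷ y′) → Congruent (Span tails) y y′
        reflect related = let (k , _ , 1≡k*1) = AffineRelated-head related in
          k , sym (trans 1≡k*1 (*-identityʳ k)) , proj₂ (proj₂ (AffineRelated-tail related))
        lift : ∀ {x} → NonzeroHead x → ∃ λ y′ → ∀ {y} → Congruent (Span tails) y y′ → ScaledCongruent (Span us) (1# ∷ y) x
        lift {x} x₀≢0 = (λ i → inv x₀ x₀≢0 * x (suc i)) , λ { {y} (k , k≡1 , w′ , w′∈ , y′≡) →
          AffineRelated-∷ {x = x}
            (x₀ , x₀≢0 , (λ i → x₀ * w′ i) , Span-scale tails x₀ w′∈ , λ i → begin
              x (suc i)                           ≡⟨ *-inv-cancel x₀ x₀≢0 (x (suc i)) ⟨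
              x₀ * (inv x₀ x₀≢0 * x (suc i))      ≡⟨ cong (x₀ *_) (y′≡ i) ⟩
              x₀ * (k * y i + w′ i)               ≡⟨ cong (λ k → x₀ * (k * y i + w′ i)) k≡1 ⟩
              x₀ * (1# * y i + w′ i)              ≡⟨ cong (λ z → x₀ * (z + w′ i)) (*-identityˡ (y i)) ⟩
              x₀ * (y i + w′ i)                   ≡⟨ distribˡ x₀ (y i) (w′ i) ⟩
              x₀ * y i + x₀ * w′ i                ∎)
            (sym (*-identityʳ x₀)) }
          where
          open ≡-Reasoning
          x₀ = x zero

      zero↮nonzero : ∀ {x y} → ZeroHead x → NonzeroHead y → ¬ ScaledCongruent (Span us) x y
      zero↮nonzero {x} {y} x₀≡0 y₀≢0 related = let (k , _ , y₀≡kx₀) = AffineRelated-head related in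
        y₀≢0 (trans y₀≡kx₀ (trans (cong (k *_) x₀≡0) (zeroʳ k)))

      nonzero↮zero : ∀ {x y} → NonzeroHead x → ZeroHead y → ¬ ScaledCongruent (Span us) x y
      nonzero↮zero {x} {y} x₀≢0 y₀≡0 related = let (k , k≢0 , y₀≡kx₀) = AffineRelated-head related in
        *-nonzero k≢0 x₀≢0 (trans (sym y₀≡kx₀) y₀≡0)

    quotientCounts : Independent us → (Independent tails → QuotientCounts tails) → QuotientCounts us
    quotientCounts us-independent counts′ = record
      { rank≤dim     = ℕ.m≤n⇒m≤1+n rank≤dim
      ; cosets       = subst (λ e → Transversal (Congruent (Span us)) (q ^ e)) (sym dim) (cosets cosets′)
      ; scaledCosets = subst (λ e → Transversal (ScaledCongruent (Span us)) (suc (geometricSum q e))) (sym dim)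
                             (scaledCosets cosets′ scaledCosets′)
      }
      where
      open QuotientCounts (counts′ (independent us-independent)) renaming (cosets to cosets′; scaledCosets to scaledCosets′)
      dim : suc m ∸ r ≡ suc (m ∸ r)
      dim = ℕ.+-∸-assoc 1 rank≤dim

  -- Gaussian elimination at a pivot us l₀ zero ≢ 0#: clearing the first coordinates of the other
  -- vectors identifies F^(m+1) modulo Span us with F^m modulo Span reduced.
  module Pivot {m r : ℕ} (us : Fin (suc r) → Vector Carrier (suc m)) (l₀ : Fin (suc r)) (p≢0 : us l₀ zero ≢ 0#) where

    p⁻¹ : Carrier
    p⁻¹ = inv (us l₀ zero) p≢0

    ratio : Fin r → Carrier
    ratio l = us (punchIn l₀ l) zero * p⁻¹

    reduced : Fin r → Vector Carrier m
    reduced l i = us (punchIn l₀ l) (suc i) + - (ratio l * us l₀ (suc i))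

    pivotCoefficient : Vector Carrier r → Carrier
    pivotCoefficient c′ = - sumF r (λ l → c′ l * ratio l)

    lincomb-insertAt : ∀ c′ x i → lincomb us (insertAt c′ l₀ x) i ≡ x * us l₀ i + sumF r (λ l → c′ l * us (punchIn l₀ l) i)
    lincomb-insertAt c′ x i = trans (sumF-remove l₀ (λ l → insertAt c′ l₀ x l * us l i))
      (cong₂ _+_ (cong (_* us l₀ i) (insertAt-lookup c′ l₀ x))
                 (sumF-cong {r} (λ l → cong (_* us (punchIn l₀ l) i) (insertAt-punchIn c′ l₀ x l))))

    pivotCoefficient-head : ∀ c′ → pivotCoefficient c′ * us l₀ zero + sumF r (λ l → c′ l * us (punchIn l₀ l) zero) ≡ 0#
    pivotCoefficient-head c′ = trans (cong (_+ S) γp≡-S) (-‿inverseˡ S)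
      where
      open ≡-Reasoning
      S = sumF r (λ l → c′ l * us (punchIn l₀ l) zero)
      γp≡-S : pivotCoefficient c′ * us l₀ zero ≡ - S
      γp≡-S = begin
        - sumF r (λ l → c′ l * ratio l) * us l₀ zero     ≡⟨ -‿distribˡ-* _ _ ⟨
        - (sumF r (λ l → c′ l * ratio l) * us l₀ zero)   ≡⟨ cong -_ (*-distribʳ-sumF {r} _ _) ⟩
        - sumF r (λ l → c′ l * ratio l * us l₀ zero)     ≡⟨ cong -_ (sumF-cong {r} (λ l → trans (*-assoc (c′ l) _ _)
                                                              (cong (c′ l *_) (trans (*-assoc _ p⁻¹ _) (cong (_ *_) (inv-l _ p≢0)))))) ⟩
        - sumF r (λ l → c′ l * (us (punchIn l₀ l) zero * 1#)) ≡⟨ cong -_ (sumF-cong {r} (λ l → cong (c′ l *_) (*-identityʳ _))) ⟩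
        - S                                              ∎

    pivotCoefficient-tail : ∀ c′ i → pivotCoefficient c′ * us l₀ (suc i) + sumF r (λ l → c′ l * us (punchIn l₀ l) (suc i))
                                     ≡ lincomb reduced c′ i
    pivotCoefficient-tail c′ i = begin
      γ * u + T                                                        ≡⟨ +-comm _ T ⟩
      T + γ * u                                                        ≡⟨ cong (T +_) γu≡ ⟩
      T + sumF r (λ l → c′ l * - (ratio l * u))                         ≡⟨ sumF-+ {r} _ _ ⟨
      sumF r (λ l → c′ l * us (punchIn l₀ l) (suc i) + c′ l * - (ratio l * u)) ≡⟨ sumF-cong {r} (λ l → distribˡ (c′ l) _ _) ⟨
      lincomb reduced c′ i                                             ∎
      where
      open ≡-Reasoning
      γ = pivotCoefficient c′
      u = us l₀ (suc i)
      T = sumF r (λ l → c′ l * us (punchIn l₀ l) (suc i))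
      γu≡ : γ * u ≡ sumF r (λ l → c′ l * - (ratio l * u))
      γu≡ = begin
        - sumF r (λ l → c′ l * ratio l) * u       ≡⟨ -‿distribˡ-* _ u ⟨
        - (sumF r (λ l → c′ l * ratio l) * u)     ≡⟨ cong -_ (*-distribʳ-sumF {r} u _) ⟩
        - sumF r (λ l → c′ l * ratio l * u)       ≡⟨ -‿distrib-sumF {r} _ ⟩
        sumF r (λ l → - (c′ l * ratio l * u))     ≡⟨ sumF-cong {r} (λ l → trans (cong -_ (*-assoc (c′ l) _ u)) (-‿distribʳ-* (c′ l) _)) ⟩
        sumF r (λ l → c′ l * - (ratio l * u))     ∎

    extendCoefficients : Vector Carrier r → Vector Carrier (suc r)
    extendCoefficients c′ = insertAt c′ l₀ (pivotCoefficient c′)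

    lincomb-extendCoefficients : ∀ c′ i → lincomb us (extendCoefficients c′) i ≡ (0# ∷ lincomb reduced c′) i
    lincomb-extendCoefficients c′ zero    = trans (lincomb-insertAt c′ _ zero) (pivotCoefficient-head c′)
    lincomb-extendCoefficients c′ (suc i) = trans (lincomb-insertAt c′ _ (suc i)) (pivotCoefficient-tail c′ i)

    extendCoefficients-removeAt : ∀ c → lincomb us c zero ≡ 0# → ∀ l → c l ≡ extendCoefficients (removeAt c l₀) l
    extendCoefficients-removeAt c head≡0 l = begin
      c l                                      ≡⟨ insertAt-removeAt c l₀ l ⟨
      insertAt c′ l₀ (c l₀) l                  ≡⟨ cong (λ x → insertAt c′ l₀ x l) pivot≡ ⟩
      insertAt c′ l₀ (pivotCoefficient c′) l   ∎
      where
      open ≡-Reasoning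
      c′ = removeAt c l₀
      pivot≡ : c l₀ ≡ pivotCoefficient c′
      pivot≡ = *-cancelʳ-nonzero p≢0 (+-cancelʳ _ _ _ (begin
        c l₀ * us l₀ zero + sumF r (λ l → c′ l * us (punchIn l₀ l) zero)
          ≡⟨ lincomb-insertAt c′ (c l₀) zero ⟨
        lincomb us (insertAt c′ l₀ (c l₀)) zero  ≡⟨ sumF-cong {suc r} (λ l → cong (_* us l zero) (insertAt-removeAt c l₀ l)) ⟩
        lincomb us c zero                        ≡⟨ head≡0 ⟩
        0#                                       ≡⟨ pivotCoefficient-head c′ ⟨
        pivotCoefficient c′ * us l₀ zero + sumF r (λ l → c′ l * us (punchIn l₀ l) zero) ∎))

    Span-cons : ∀ {w′} → Span reduced w′ → Span us (0# ∷ w′)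
    Span-cons (c′ , w′≡) = extendCoefficients c′ , λ
      { zero    → sym (lincomb-extendCoefficients c′ zero)
      ; (suc i) → trans (w′≡ i) (sym (lincomb-extendCoefficients c′ (suc i))) }

    lincomb-removeAt : ∀ c → lincomb us c zero ≡ 0# → ∀ i → lincomb us c (suc i) ≡ lincomb reduced (removeAt c l₀) i
    lincomb-removeAt c head≡0 i = trans (sumF-cong {suc r} (λ l → cong (_* us l (suc i)) (extendCoefficients-removeAt c head≡0 l)))
                                        (lincomb-extendCoefficients (removeAt c l₀) (suc i))

    Span-tail : ∀ {w} → Span us w → w zero ≡ 0# → Span reduced (tail w)
    Span-tail (c , w≡) w₀≡0 = removeAt c l₀ , λ i → trans (w≡ (suc i)) (lincomb-removeAt c (trans (sym (w≡ zero)) w₀≡0) i)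

    independent : Independent us → Independent reduced
    independent us-independent c′ combination≡0 l = begin
      c′ l                                     ≡⟨ insertAt-punchIn c′ l₀ _ l ⟨
      extendCoefficients c′ (punchIn l₀ l)     ≡⟨ us-independent (extendCoefficients c′) combination≡0′ (punchIn l₀ l) ⟩
      0#                                       ∎
      where
      open ≡-Reasoning
      combination≡0′ : ∀ i → lincomb us (extendCoefficients c′) i ≡ 0#
      combination≡0′ zero    = lincomb-extendCoefficients c′ zero
      combination≡0′ (suc i) = trans (lincomb-extendCoefficients c′ (suc i)) (combination≡0 i)

    residue : Vector Carrier (suc m) → Vector Carrier m
    residue x i = x (suc i) + - (x zero * p⁻¹ * us l₀ (suc i))

    decompose : ∀ x i → x i ≡ (0# ∷ residue x) i + x zero * p⁻¹ * us l₀ i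
    decompose x zero = begin
      x zero                            ≡⟨ *-identityʳ _ ⟨
      x zero * 1#                       ≡⟨ cong (x zero *_) (inv-l _ p≢0) ⟨
      x zero * (p⁻¹ * us l₀ zero)       ≡⟨ *-assoc _ _ _ ⟨
      x zero * p⁻¹ * us l₀ zero         ≡⟨ +-identityˡ _ ⟨
      0# + x zero * p⁻¹ * us l₀ zero    ∎
      where open ≡-Reasoning
    decompose x (suc i) = begin
      x (suc i)                    ≡⟨ +-identityʳ _ ⟨
      x (suc i) + 0#               ≡⟨ cong (x (suc i) +_) (-‿inverseˡ v) ⟨
      x (suc i) + (- v + v)        ≡⟨ +-assoc _ _ _ ⟨
      x (suc i) + - v + v          ∎
      where
      open ≡-Reasoning
      v = x zero * p⁻¹ * us l₀ (suc i)

    quotientCounts : Independent us → (Independent reduced → QuotientCounts reduced) → QuotientCounts us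
    quotientCounts us-independent counts′ = record
      { rank≤dim     = s≤s rank≤dim
      ; cosets       = reduce cosets′
      ; scaledCosets = reduce scaledCosets′
      }
      where
      open QuotientCounts (counts′ (independent us-independent)) renaming (cosets to cosets′; scaledCosets to scaledCosets′)
      reduce : ∀ {K d} → Transversal (AffineRelated K (Span reduced)) d → Transversal (AffineRelated K (Span us)) d
      reduce = Transversal-reduce {us = us} {us′ = reduced} Span-tail Span-cons
        (λ x → residue x , _ , Span-scale us (x zero * p⁻¹) (Span-member us l₀) , decompose x)

  quotientCounts : ∀ m {r} (us : Fin r → Vector Carrier m) → Independent us → QuotientCounts us
  quotientCounts zero    us us-independent = quotientCounts-dim0 us us-independent
  quotientCounts (suc m) {zero}  us us-independent = ZeroFirstCoordinate.quotientCounts us (λ ()) us-independent (quotientCounts m _)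
  quotientCounts (suc m) {suc r} us us-independent with any? (λ l → ¬? (us l zero ≟ 0#))
  ... | yes (l₀ , p≢0) = Pivot.quotientCounts us l₀ p≢0 us-independent (quotientCounts m _)
  ... | no  no-pivot   = ZeroFirstCoordinate.quotientCounts us heads≡0 us-independent (quotientCounts m _)
    where
    heads≡0 : ∀ l → us l zero ≡ 0#
    heads≡0 l = decidable-stable (us l zero ≟ 0#) (λ u≢0 → no-pivot (l , u≢0))

  ¬¬Span-of-dependent : ∀ {m r} {us : Fin r → Vector Carrier m} {v} → Independent us → ¬ Independent (v ∷ us) → ¬ ¬ Span us v
  ¬¬Span-of-dependent {r = r} {us} {v} us-independent v∷us-dependent v∉Span = v∷us-dependent v∷us-independent
    where
    v∷us-independent : Independent (v ∷ us)
    v∷us-independent c combination≡0 with c zero ≟ 0#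
    ... | yes c₀≡0 = λ
      { zero    → c₀≡0
      ; (suc l) → us-independent (c ∘ suc) (λ i → trans (sym (+-identityˡ _))
          (trans (cong (_+ lincomb us (c ∘ suc) i) (trans (sym (zeroˡ (v i))) (cong (_* v i) (sym c₀≡0)))) (combination≡0 i))) l }
    ... | no c₀≢0 = ⊥-elim (v∉Span ((λ l → - (c₀⁻¹ * c (suc l))) , v≡))
      where
      c₀⁻¹ = inv (c zero) c₀≢0
      v≡ : ∀ i → v i ≡ lincomb us (λ l → - (c₀⁻¹ * c (suc l))) i
      v≡ i = begin
        v i                                          ≡⟨ inv-*-cancel (c zero) c₀≢0 (v i) ⟨
        c₀⁻¹ * (c zero * v i)                        ≡⟨ cong (c₀⁻¹ *_) (+-cancelʳ S _ _ (trans (combination≡0 i) (sym (-‿inverseˡ S)))) ⟩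
        c₀⁻¹ * - S                                   ≡⟨ -‿distribʳ-* c₀⁻¹ S ⟨
        - (c₀⁻¹ * S)                                 ≡⟨ cong -_ (*-distribˡ-sumF {r} c₀⁻¹ _) ⟩
        - sumF r (λ l → c₀⁻¹ * (c (suc l) * us l i)) ≡⟨ -‿distrib-sumF {r} _ ⟩
        sumF r (λ l → - (c₀⁻¹ * (c (suc l) * us l i)))
          ≡⟨ sumF-cong {r} (λ l → trans (cong -_ (sym (*-assoc c₀⁻¹ _ _))) (-‿distribˡ-* _ _)) ⟩
        lincomb us (λ l → - (c₀⁻¹ * c (suc l))) i    ∎
        where
        open ≡-Reasoning
        S = lincomb us (c ∘ suc) i

  ¬¬-∀-Fin : ∀ {n} {P : Fin n → Set} → (∀ j → ¬ ¬ P j) → ¬ ¬ (∀ j → P j)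
  ¬¬-∀-Fin {zero}      _    ¬∀ = ¬∀ (λ ())
  ¬¬-∀-Fin {suc n} {P} ¬¬Pj ¬∀ = ¬¬Pj zero λ P₀ → ¬¬-∀-Fin {P = P ∘ suc} (¬¬Pj ∘ suc) λ Psuc →
    ¬∀ λ { zero → P₀ ; (suc j) → Psuc j }

  ¬¬columns∈Span : ∀ {m n r} {A : Mat m n} (rank : Rank A r) → ¬ ¬ (∀ j → Span (columns A ∘ proj₁ (proj₁ rank)) (columns A j))
  ¬¬columns∈Span ((cols , independent) , maximal) = ¬¬-∀-Fin λ j → ¬¬Span-of-dependent independent (maximal (j ∷ cols))

  module _ {n : ℕ} {N : Mat n n} (N∈Uo : Uo n N) {i : ℕ} (child : Fin i → Mat (suc n) (suc n))
           (distinct : ∀ j j′ → Conj (suc n) (child j) (child j′) → j ≡ j′)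
           (cover : ∀ N′ → Uo (suc n) N′ → Conj n (top N′) N → ∃ λ j → Conj (suc n) (child j) N′)
           (deg : Fin i → ℕ) (degrees : ∀ j → MatrixDeg N (child j) (deg j)) where

    children-transversal : Transversal (ScaledCongruent (Span (columns N))) (sumℕ i deg)
    children-transversal = HasOrbitCount⇒Transversal {R = R} every-b-has-a-class
      (HasOrbitCount-⋃ {R = R} i (λ j → Bset N (child j)) deg orbits separated)
      where
      R = ScaledCongruent (Span (columns N))
      orbits : ∀ j → HasOrbitCount (Bset N (child j)) R (deg j)
      orbits j = HasOrbitCount-respRel {R = λ b b′ → BangConj (extend N b) (extend N b′)}
        (BangConj-extend⇒ScaledCongruent N) (ScaledCongruent⇒BangConj-extend N) (degrees j)
      separated : ∀ {j j′ b b′} → Bset N (child j) b → Bset N (child j′) b′ → R b b′ → j ≡ j′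
      separated {j} {j′} {b} {b′} b∈ b′∈ related = distinct j j′
        (Conj-trans {M = child j} (Conj-sym {M = extend N b} b∈)
          (Conj-trans {M = extend N b} (BangConj⇒Conj {M = extend N b} (ScaledCongruent⇒BangConj-extend N related)) b′∈))
      every-b-has-a-class : ∀ b → ∃ λ j → Bset N (child j) b
      every-b-has-a-class b = let (j , conj) = cover (extend N b) (Uo-extend N∈Uo b) (top-extend N b) in
        j , Conj-sym {M = child j} conj

    -- Rank only says that no further column is independent of the chosen ones, so the columns lie
    -- in their span up to double negation; as the goal is a decidable equation, that suffices.
    sum-matrixDeg : ∀ {r} → Rank N r → sumℕ i deg ≡ suc (geometricSum q (n ∸ r))
    sum-matrixDeg {r} rank@((cols , independent) , _) = decidable-stable (sumℕ i deg ℕ.≟ _)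
      λ sum≢ → ¬¬columns∈Span rank λ columns∈ → sum≢ (Transversal-size-unique
        (ScaledCongruent-sym (columns N)) (ScaledCongruent-trans (columns N))
        children-transversal
        (HasOrbitCount-respRel {R = ScaledCongruent (Span (columns N ∘ cols))}
          (AffineRelated-mono (Span-⊆ (columns N) chosen∈)) (AffineRelated-mono (Span-⊆ (columns N ∘ cols) columns∈))
          (QuotientCounts.scaledCosets (quotientCounts n (columns N ∘ cols) independent))))
      where
      chosen∈ : ∀ l → Span (columns N) (columns N (cols l))
      chosen∈ l = Span-member (columns N) (cols l)

open Defs using (Mat; Uo; Rank; Conj; top; MatrixDeg; q)
open import Data.Nat using (_+_)
open import Data.Nat.DivMod using (_/_)

proposition2p5 :
    (F : FiniteField) (n : ℕ) → 1 ≤ n →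
    (N : Mat F n n) → Uo F n N →
    (r : ℕ) → Rank F N r →
    (i : ℕ) (child : Fin i → Mat F (suc n) (suc n)) →
    (∀ j → Uo F (suc n) (child j)) →
    (∀ j → Conj F n (top F (child j)) N) →
    (∀ j j' → Conj F (suc n) (child j) (child j') → j ≡ j') →
    (∀ N' → Uo F (suc n) N' → Conj F n (top F N') N → ∃ λ j → Conj F (suc n) (child j) N') →
    (deg : Fin i → ℕ) → (∀ j → MatrixDeg F N (child j) (deg j)) →
    sumℕ i deg ≡ (_/_ (q F ^ (n ∸ r) ∸ 1) (q F ∸ 1) {{q∸1-nonZero F}}) + 1
proposition2p5 F n _ N N∈Uo r rank i child _ _ distinct cover deg degrees =
  trans (sum-matrixDeg F N∈Uo child distinct cover deg degrees rank)
        (suc-geometricSum (q F) (n ∸ r) {{q∸1-nonZero F}})
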